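{- For every formula $A$ of $\mathcal{L}_{PAL}$, if $\vDash_{PAL} A$, then the DHS $\Rightarrow A$ (a single dynamic sequent consisting of the single $\epsilon$-labelled component with empty antecedent and succedent $A$) is derivable in $\mathbf{DHS}_{PAL}$.
   Context: Formulas of $\mathcal{L}_{PAL}$ are generated by $A ::= p \mid \neg A \mid (A\wedge A) \mid \Box A \mid [A]A$ from a countable set of atoms. Semantics: an epistemic model is $M=(W,\sim,V)$ with $W$ a set, $\sim$ an equivalence relation on $W$, $V$ assigning to each atom a subset of $W$. Satisfaction and updated models are defined simultaneously: $M,w\vDash p$ iff $w\in V(p)$; $M,w\vDash\neg A$ iff not $M,w\vDash A$; $M,w\vDash A\wedge B$ iff both; $M,w\vDash\Box A$ iff $M,v\vDash A$ for all $v$ with $w\sim v$; $M,w\vDash[A]B$ iff ($M,w\vDash A$ implies $M_A,w\vDash B$), where $M_A=(W_A,\sim_A,V_A)$ with $W_A=\{w\in W: M,w\vDash A\}$, $\sim_A = \sim\cap W_A^2$, $V_A(p)=V(p)\cap W_A$. $\vDash_{PAL}A$ means $M,w\vDash A$ for all models $M$ and worlds $w$. Syntax of the calculus: a list of announcements is a finite (possibly empty, $\epsilon$) sequence of formulas, $\alpha\cdot A$ its extension by $A$. A sequent is $M\Rightarrow N$ ($M,N$ finite multisets); $A,\Gamma$ / $\Gamma,A$ add $A$ to antecedent / succedent. A dynamic sequent is $/\!/_{\alpha_1}\Gamma_1/\!/\cdots/\!/_{\alpha_n}\Gamma_n$ (components labelled by lists of announcements; $/\!/_\epsilon\Gamma$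 written $\Gamma$); a DHS is $X_1\mid\cdots\mid X_n$ of dynamic sequents. $G\mid X/\!/_\alpha M\Rightarrow N$ denotes a DHS with a dynamic sequent having component labelled $\alpha$ equal to $M\Rightarrow N$, $X$ the rest of that dynamic sequent and $G$ the rest of the DHS (possibly empty). Calculus $\mathbf{DHS}_{PAL}$: Axioms $G\mid X/\!/_\alpha p,M\Rightarrow N,p$. (L$\neg$) $G\mid X/\!/_\alpha M\Rightarrow N,A$ / $G\mid X/\!/_\alpha\neg A,M\Rightarrow N$; (R$\neg$) $G\mid X/\!/_\alpha A,M\Rightarrow N$ / $G\mid X/\!/_\alpha M\Rightarrow N,\neg A$; (L$\wedge$) $G\mid X/\!/_\alpha A,B,M\Rightarrow N$ / $G\mid X/\!/_\alpha A\wedge B,M\Rightarrow N$; (R$\wedge$) $G\mid X/\!/_\alpha M\Rightarrow N,A$ and $G\mid X/\!/_\alpha M\Rightarrow N,B$ / $G\mid X/\!/_\alpha M\Rightarrow N,A\wedge B$; (L$\Box_1$) $G\mid X/\!/_\alpha\Box A,A,M\Rightarrow N$ / $G\mid X/\!/_\alpha\Box A,M\Rightarrow N$; (R$\Box$) $G\mid X/\!/_\alpha M\Rightarrow N\mid/\!/_\alpha\Rightarrow A$ / $G\mid X/\!/_\alpha M\Rightarrow N,\Box A$; (L$\Box_2$) $G\mid X/\!/_\alpha\Box A,M\Rightarrow N\mid Y/\!/_\alpha A,P\Rightarrow Q$ / $G\mid X/\!/_\alpha\Box A,M\Rightarrow N\mid Y/\!/_\alpha P\Rightarrow Q$; (L$\Box_3$)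 with $\beta=B_1\cdots B_n$, $\overline{Y}=Y/\!/_{\alpha\cdot\beta}\Box A,\Delta$: premises $G\mid X/\!/_\alpha\Gamma,B_1\mid\overline{Y}$, $G\mid X/\!/_\alpha\Gamma/\!/_{\alpha\cdot B_1\cdots B_i}\Rightarrow B_{i+1}\mid\overline{Y}$ ($1\le i<n$), $G\mid X/\!/_\alpha\Gamma/\!/_{\alpha\cdot\beta}A\Rightarrow\ \mid\overline{Y}$, conclusion $G\mid X/\!/_\alpha\Gamma\mid Y/\!/_{\alpha\cdot\beta}\Box A,\Delta$; (L$[\cdot]$) $G\mid X/\!/_\alpha M\Rightarrow N,A/\!/_{\alpha\cdot A}M'\Rightarrow N'$ and $G\mid X/\!/_\alpha M\Rightarrow N/\!/_{\alpha\cdot A}B,M'\Rightarrow N'$ / $G\mid X/\!/_\alpha[A]B,M\Rightarrow N/\!/_{\alpha\cdot A}M'\Rightarrow N'$; (R$[\cdot]$) $G\mid X/\!/_\alpha A,M\Rightarrow N/\!/_{\alpha\cdot A}M'\Rightarrow N',B$ / $G\mid X/\!/_\alpha M\Rightarrow N,[A]B/\!/_{\alpha\cdot A}M'\Rightarrow N'$ (in both, if no $\alpha\cdot A$ component is in the conclusion, the premises — for (L$[\cdot]$) the right one — contain a new component $/\!/_{\alpha\cdot A}$ with $M',N'$ empty); (Lat) $G\mid X/\!/_\alpha p,M\Rightarrow N/\!/_{\alpha\cdot A}p,M'\Rightarrow N'$ / $G\mid X/\!/_\alpha M\Rightarrow N/\!/_{\alpha\cdot A}p,M'\Rightarrow N'$;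 (Rat) $G\mid X/\!/_\alpha M\Rightarrow N,p/\!/_{\alpha\cdot A}M'\Rightarrow N',p$ / $G\mid X/\!/_\alpha M\Rightarrow N/\!/_{\alpha\cdot A}M'\Rightarrow N',p$; (New) $G\mid X/\!/_\alpha\Rightarrow\ /\!/_{\alpha\cdot A}M\Rightarrow N$ / $G\mid X/\!/_{\alpha\cdot A}M\Rightarrow N$; (Recall) $G\mid X/\!/_\alpha A,M\Rightarrow N/\!/_{\alpha\cdot A}M'\Rightarrow N'$ / $G\mid X/\!/_\alpha M\Rightarrow N/\!/_{\alpha\cdot A}M'\Rightarrow N'$. (Notation "premises / conclusion".) -}

module Defs where

open import Level using (Level; suc)
open import Data.Nat using (ℕ)
open import Data.List using (List; []; _∷_; _++_; _∷ʳ_; [_])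
open import Data.List.Relation.Unary.All using (All)
open import Data.List.Relation.Binary.Permutation.Propositional using (_↭_)
open import Data.Product using (Σ; _,_; proj₁; _×_)
open import Relation.Nullary using (¬_)
open import Relation.Binary.Structures using (IsEquivalence)
open import Relation.Binary.PropositionalEquality using (_≡_; _≢_)

infixr 30 ¬'_ □_ ⟦_⟧_
infixr 25 _∧'_

data Fm : Set where
  atom  : ℕ → Fm
  ¬'_   : Fm → Fm
  _∧'_  : Fm → Fm → Fm
  □_    : Fm → Fm
  ⟦_⟧_  : Fm → Fm → Fm

record Model : Set₁ where
  field
    W     : Set
    _∼_   : W → W → Set
    isEqv : IsEquivalence _∼_
    V     : ℕ → W → Set

open Model

mutual
  update : Model → Fm → Model
  update M A = record
    { W     = Σ (W M) (λ w → Sat M w A)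
    ; _∼_   = λ u v → _∼_ M (proj₁ u) (proj₁ v)
    ; isEqv = record
        { refl  = IsEquivalence.refl (isEqv M)
        ; sym   = IsEquivalence.sym (isEqv M)
        ; trans = IsEquivalence.trans (isEqv M) }
    ; V     = λ p u → V M p (proj₁ u)
    }

  Sat : (M : Model) → W M → Fm → Set
  Sat M w (atom p)  = V M p w
  Sat M w (¬' A)    = ¬ Sat M w A
  Sat M w (A ∧' B)  = Sat M w A × Sat M w B
  Sat M w (□ A)     = ∀ v → _∼_ M w v → Sat M v A
  Sat M w (⟦ A ⟧ B) = (h : Sat M w A) → Sat (update M A) (w , h) B

⊨PAL : Fm → Set₁
⊨PAL A = (M : Model) (w : W M) → Sat M w A

-- Dynamic hypersequents.  Multisets are represented by lists, taken up to
-- permutation via the explicit exchange rules exDHS / exDS / exSeq below.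

Ann : Set            -- list of announcements; α · A is  α ∷ʳ A
Ann = List Fm

infix 4 _⇒_
record Seq : Set where
  constructor _⇒_
  field
    ant : List Fm
    scd : List Fm

infix 3 _▸_
record Comp : Set where
  constructor _▸_
  field
    label : Ann
    seqt  : Seq
open Comp

DS : Set
DS = List Comp

DHS : Set
DHS = List DS

data ⊢ : DHS → Set where
  exDHS : ∀ {G G'} → G ↭ G' → ⊢ G → ⊢ G'
  exDS  : ∀ {X X' G} → X ↭ X' → ⊢ (X ∷ G) → ⊢ (X' ∷ G)
  exSeq : ∀ {α M M' N N' X G} → M ↭ M' → N ↭ N' →
          ⊢ (((α ▸ M ⇒ N) ∷ X) ∷ G) → ⊢ (((α ▸ M' ⇒ N') ∷ X) ∷ G)

  ax    : ∀ {α p M N X G} → ⊢ (((α ▸ atom p ∷ M ⇒ atom p ∷ N) ∷ X) ∷ G)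

  L¬    : ∀ {α A M N X G} → ⊢ (((α ▸ M ⇒ A ∷ N) ∷ X) ∷ G)
                          → ⊢ (((α ▸ ¬' A ∷ M ⇒ N) ∷ X) ∷ G)
  R¬    : ∀ {α A M N X G} → ⊢ (((α ▸ A ∷ M ⇒ N) ∷ X) ∷ G)
                          → ⊢ (((α ▸ M ⇒ ¬' A ∷ N) ∷ X) ∷ G)
  L∧    : ∀ {α A B M N X G} → ⊢ (((α ▸ A ∷ B ∷ M ⇒ N) ∷ X) ∷ G)
                            → ⊢ (((α ▸ A ∧' B ∷ M ⇒ N) ∷ X) ∷ G)
  R∧    : ∀ {α A B M N X G} → ⊢ (((α ▸ M ⇒ A ∷ N) ∷ X) ∷ G)
                            → ⊢ (((α ▸ M ⇒ B ∷ N) ∷ X) ∷ G)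
                            → ⊢ (((α ▸ M ⇒ A ∧' B ∷ N) ∷ X) ∷ G)
  L□₁   : ∀ {α A M N X G} → ⊢ (((α ▸ □ A ∷ A ∷ M ⇒ N) ∷ X) ∷ G)
                          → ⊢ (((α ▸ □ A ∷ M ⇒ N) ∷ X) ∷ G)
  R□    : ∀ {α A M N X G} → ⊢ (((α ▸ M ⇒ N) ∷ X) ∷ ((α ▸ [] ⇒ [ A ]) ∷ []) ∷ G)
                          → ⊢ (((α ▸ M ⇒ □ A ∷ N) ∷ X) ∷ G)
  L□₂   : ∀ {α A M N P Q X Y G}
          → ⊢ (((α ▸ □ A ∷ M ⇒ N) ∷ X) ∷ ((α ▸ A ∷ P ⇒ Q) ∷ Y) ∷ G)
          → ⊢ (((α ▸ □ A ∷ M ⇒ N) ∷ X) ∷ ((α ▸ P ⇒ Q) ∷ Y) ∷ G)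
  -- β = B ∷ Bs  (i.e. B₁ ⋯ Bₙ with n ≥ 1);  Γ = M ⇒ N;  Δ = P ⇒ Q
  L□₃   : ∀ {α A B Bs M N P Q X Y G} →
          let β  = B ∷ Bs
              Yb = (α ++ β ▸ □ A ∷ P ⇒ Q) ∷ Y
          in ⊢ (((α ▸ M ⇒ B ∷ N) ∷ X) ∷ Yb ∷ G)
          → (∀ pre C suf → β ≡ pre ++ C ∷ suf → pre ≢ [] →
               ⊢ (((α ▸ M ⇒ N) ∷ (α ++ pre ▸ [] ⇒ [ C ]) ∷ X) ∷ Yb ∷ G))
          → ⊢ (((α ▸ M ⇒ N) ∷ (α ++ β ▸ [ A ] ⇒ []) ∷ X) ∷ Yb ∷ G)
          → ⊢ (((α ▸ M ⇒ N) ∷ X) ∷ Yb ∷ G)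

  L[] : ∀ {α A B M N M' N' X G}
        → ⊢ (((α ▸ M ⇒ A ∷ N) ∷ (α ∷ʳ A ▸ M' ⇒ N') ∷ X) ∷ G)
        → ⊢ (((α ▸ M ⇒ N) ∷ (α ∷ʳ A ▸ B ∷ M' ⇒ N') ∷ X) ∷ G)
        → ⊢ (((α ▸ ⟦ A ⟧ B ∷ M ⇒ N) ∷ (α ∷ʳ A ▸ M' ⇒ N') ∷ X) ∷ G)
  R[] : ∀ {α A B M N M' N' X G}
        → ⊢ (((α ▸ A ∷ M ⇒ N) ∷ (α ∷ʳ A ▸ M' ⇒ B ∷ N') ∷ X) ∷ G)
        → ⊢ (((α ▸ M ⇒ ⟦ A ⟧ B ∷ N) ∷ (α ∷ʳ A ▸ M' ⇒ N') ∷ X) ∷ G)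
  L[]new : ∀ {α A B M N X G} → All (λ c → label c ≢ α ∷ʳ A) X
        → ⊢ (((α ▸ M ⇒ A ∷ N) ∷ X) ∷ G)
        → ⊢ (((α ▸ M ⇒ N) ∷ (α ∷ʳ A ▸ [ B ] ⇒ []) ∷ X) ∷ G)
        → ⊢ (((α ▸ ⟦ A ⟧ B ∷ M ⇒ N) ∷ X) ∷ G)
  R[]new : ∀ {α A B M N X G} → All (λ c → label c ≢ α ∷ʳ A) X
        → ⊢ (((α ▸ A ∷ M ⇒ N) ∷ (α ∷ʳ A ▸ [] ⇒ [ B ]) ∷ X) ∷ G)
        → ⊢ (((α ▸ M ⇒ ⟦ A ⟧ B ∷ N) ∷ X) ∷ G)

  Lat : ∀ {α A p M N M' N' X G}
        → ⊢ (((α ▸ atom p ∷ M ⇒ N) ∷ (α ∷ʳ A ▸ atom p ∷ M' ⇒ N') ∷ X) ∷ G)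
        → ⊢ (((α ▸ M ⇒ N) ∷ (α ∷ʳ A ▸ atom p ∷ M' ⇒ N') ∷ X) ∷ G)
  Rat : ∀ {α A p M N M' N' X G}
        → ⊢ (((α ▸ M ⇒ atom p ∷ N) ∷ (α ∷ʳ A ▸ M' ⇒ atom p ∷ N') ∷ X) ∷ G)
        → ⊢ (((α ▸ M ⇒ N) ∷ (α ∷ʳ A ▸ M' ⇒ atom p ∷ N') ∷ X) ∷ G)
  New : ∀ {α A M N X G}
        → ⊢ (((α ▸ [] ⇒ []) ∷ (α ∷ʳ A ▸ M ⇒ N) ∷ X) ∷ G)
        → ⊢ (((α ∷ʳ A ▸ M ⇒ N) ∷ X) ∷ G)
  Recall : ∀ {α A M N Γ' X G}
        → ⊢ (((α ▸ A ∷ M ⇒ N) ∷ (α ∷ʳ A ▸ Γ') ∷ X) ∷ G)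
        → ⊢ (((α ▸ M ⇒ N) ∷ (α ∷ʳ A ▸ Γ') ∷ X) ∷ G)

{-# OPTIONS --safe #-}
module Submission where

-- Completeness by terminating backward proof search.  A search state is a hypersequent whose
-- dynamic sequents also remember the items (components and labelled formula occurrences) that
-- rules have already decomposed.  While some item is unsaturated, the matching rule adds an item
-- that is relevant: built from subformulas of A, under labels whose announcements fit within the
-- announcement depth of A.  There are finitely many relevant items, so a lexicographic count of
-- missing ones decreases.  A saturated state without axioms yields a countermodel: one world per
-- dynamic sequent, the universal relation, and as valuation the atoms on the left of the root
-- components.  A truth lemma, by induction on the size of label and formula, shows that A fails
-- at the world of the sequent holding the goal, contradicting validity.

open import Defs
open import Data.Empty using (⊥; ⊥-elim)
open import Data.Fin using (Fin)
open import Data.List using (List; []; _∷_; [_]; _++_; _∷ʳ_; length; map; concatMap; lookup; initLast; _∷ʳ′_)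
open import Data.List.Properties using (≡-dec; ∷ʳ-injective; length-++; ++-assoc; ++-identityʳ)
open import Data.List.Membership.Propositional using (_∈_; find)
open import Data.List.Membership.Propositional.Properties
  using (∈-∃++; ∈-map⁺; ∈-map⁻; ∈-++⁺ˡ; ∈-++⁺ʳ; ∈-++⁻; ∈-concatMap⁺; ∈-concatMap⁻; ∈-lookup)
open import Data.List.Relation.Binary.Permutation.Propositional using (_↭_; ↭-refl; ↭-sym; ↭-trans; prep; swap)
open import Data.List.Relation.Binary.Permutation.Propositional.Properties
  using (shift; All-resp-↭; Any-resp-↭; ∈-resp-↭; ↭-length; map⁺)
open import Data.List.Relation.Unary.All using (All; []; _∷_; all?)
import Data.List.Relation.Unary.All as All
open import Data.List.Relation.Unary.All.Properties using (¬Any⇒All¬; ¬All⇒Any¬) renaming (++⁺ to All-++⁺)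
open import Data.List.Relation.Unary.Any using (Any; here; there; any?; index)
import Data.List.Relation.Unary.Any as Any
open import Data.List.Relation.Unary.Any.Properties using (lookup-index)
open import Data.List.Reverse using (Reverse; []; _∶_∶ʳ_; reverseView)
open import Data.Nat using (ℕ; zero; suc; _+_; _*_; _≤_; _<_; _⊔_; z≤n; s≤s)
open import Data.Nat.Induction using (<-wellFounded)
open import Data.Nat.ListAction using (sum)
open import Data.Nat.ListAction.Properties using (sum-↭)
open import Data.Nat.Properties
open import Data.Product using (Σ; ∃-syntax; _×_; _,_; proj₁; proj₂; map₁)
open import Data.Sum using (_⊎_; inj₁; inj₂; [_,_]′)
open import Data.Unit using (⊤; tt)
open import Function using (id; _∘_)
open import Induction.WellFounded using (Acc; acc)
open import Relation.Binary.Definitions using (DecidableEquality)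
open import Relation.Binary.PropositionalEquality using (_≡_; _≢_; refl; sym; trans; cong; subst)
open import Relation.Nullary using (¬_; Dec; yes; no; contradiction)
open import Relation.Nullary.Decidable using (_×-dec_; _⊎-dec_; _→-dec_; ¬?; map′)
open import Relation.Unary using (Decidable)

open Model
open Comp
open Seq

module _ {A : Set} where

  extract : ∀ {P : A → Set} {xs} → Any P xs → ∃[ x ] P x × ∃[ ys ] xs ↭ x ∷ ys
  extract p with x , x∈xs , px ← find p with ys , zs , refl ← ∈-∃++ x∈xs = x , px , ys ++ zs , shift x ys zs

  ∈⇒↭ : ∀ {x : A} {xs} → x ∈ xs → ∃[ ys ] xs ↭ x ∷ ys
  ∈⇒↭ x∈xs with _ , refl , ys , π ← extract x∈xs = ys , π

  splits : List A → List (List A × A × List A)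
  splits []       = []
  splits (x ∷ xs) = ([] , x , xs) ∷ map (map₁ (x ∷_)) (splits xs)

  ∈-splits⁻ : ∀ xs {pre c suf} → (pre , c , suf) ∈ splits xs → xs ≡ pre ++ c ∷ suf
  ∈-splits⁻ (x ∷ xs) (here refl) = refl
  ∈-splits⁻ (x ∷ xs) (there m) with _ , m′ , refl ← ∈-map⁻ (map₁ (x ∷_)) m = cong (x ∷_) (∈-splits⁻ xs m′)

  ∈-splits⁺ : ∀ pre c suf → (pre , c , suf) ∈ splits (pre ++ c ∷ suf)
  ∈-splits⁺ []        c suf = here refl
  ∈-splits⁺ (x ∷ pre) c suf = there (∈-map⁺ (map₁ (x ∷_)) (∈-splits⁺ pre c suf))

  ∈-concatMap⁺′ : ∀ {B : Set} (f : A → List B) {x xs y} → x ∈ xs → y ∈ f x → y ∈ concatMap f xs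
  ∈-concatMap⁺′ f x∈xs y∈fx = ∈-concatMap⁺ f (Any.map (λ { refl → y∈fx }) x∈xs)

  listsOver : List A → ℕ → List (List A)
  listsOver xs zero    = [ [] ]
  listsOver xs (suc n) = [] ∷ concatMap (λ x → map (x ∷_) (listsOver xs n)) xs

  ∈-listsOver : ∀ {xs} n ys → All (_∈ xs) ys → length ys ≤ n → ys ∈ listsOver xs n
  ∈-listsOver zero    []       _              _         = here refl
  ∈-listsOver (suc n) []       _              _         = here refl
  ∈-listsOver (suc n) (y ∷ ys) (y∈xs ∷ ys⊆xs) (s≤s ≤n) =
    there (∈-concatMap⁺′ (λ x → map (x ∷_) (listsOver _ n)) y∈xs (∈-map⁺ (y ∷_) (∈-listsOver n ys ys⊆xs ≤n)))

  ∷ʳ≢[] : ∀ {xs : List A} {x} → xs ∷ʳ x ≢ []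
  ∷ʳ≢[] {[]}    ()
  ∷ʳ≢[] {_ ∷ _} ()

  length-∷ʳ : ∀ (xs : List A) x → length (xs ∷ʳ x) ≡ suc (length xs)
  length-∷ʳ xs x = trans (length-++ xs) (+-comm (length xs) 1)

  ∷ʳ≢ : ∀ (xs : List A) x → xs ∷ʳ x ≢ xs
  ∷ʳ≢ xs x eq = 1+n≢n (trans (sym (length-∷ʳ xs x)) (cong length eq))

  ForInitLast : List A → (List A → A → Set) → Set
  ForInitLast xs P = ∀ ys y → xs ≡ ys ∷ʳ y → P ys y

  ForInitLast-∷ʳ : ∀ {P ys y} → P ys y → ForInitLast (ys ∷ʳ y) P
  ForInitLast-∷ʳ {ys = ys} p ys′ y′ eq with refl , refl ← ∷ʳ-injective ys ys′ eq = p

  forInitLast? : ∀ xs {P} → (∀ ys y → Dec (P ys y)) → Dec (ForInitLast xs P)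
  forInitLast? xs P? with initLast xs
  ... | []       = yes λ _ _ eq → ⊥-elim (∷ʳ≢[] (sym eq))
  ... | ys ∷ʳ′ y = map′ ForInitLast-∷ʳ (λ f → f ys y refl) (P? ys y)

  ¬ForInitLast : ∀ xs {P} → ¬ ForInitLast xs P → ∃[ ys ] ∃[ y ] xs ≡ ys ∷ʳ y × ¬ P ys y
  ¬ForInitLast xs ¬f with initLast xs
  ... | []       = ⊥-elim (¬f λ _ _ eq → ⊥-elim (∷ʳ≢[] (sym eq)))
  ... | ys ∷ʳ′ y = ys , y , refl , λ p → ¬f (ForInitLast-∷ʳ p)

  count : {P : A → Set} → Decidable P → List A → ℕ
  count P? []       = 0
  count P? (x ∷ xs) with P? x
  ... | yes _ = suc (count P? xs)
  ... | no  _ = count P? xs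

  count≤length : {P : A → Set} (P? : Decidable P) → ∀ xs → count P? xs ≤ length xs
  count≤length P? []       = z≤n
  count≤length P? (x ∷ xs) with P? x
  ... | yes _ = s≤s (count≤length P? xs)
  ... | no  _ = m≤n⇒m≤1+n (count≤length P? xs)

  module _ {P Q : A → Set} (P? : Decidable P) (Q? : Decidable Q) (P⇒Q : ∀ {x} → P x → Q x) where

    count-mono : ∀ xs → count P? xs ≤ count Q? xs
    count-mono []       = z≤n
    count-mono (x ∷ xs) with P? x | Q? x
    ... | yes _ | yes _  = s≤s (count-mono xs)
    ... | yes p | no ¬q  = contradiction (P⇒Q p) ¬q
    ... | no  _ | yes _  = m≤n⇒m≤1+n (count-mono xs)
    ... | no  _ | no  _  = count-mono xs

    count-mono-< : ∀ {y xs} → y ∈ xs → Q y → ¬ P y → count P? xs < count Q? xs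
    count-mono-< {xs = x ∷ xs} (here refl) qy ¬py with P? x | Q? x
    ... | yes py | _     = contradiction py ¬py
    ... | no  _  | no ¬q = contradiction qy ¬q
    ... | no  _  | yes _ = s≤s (count-mono xs)
    count-mono-< {xs = x ∷ xs} (there y∈xs) qy ¬py with P? x | Q? x
    ... | yes _ | yes _  = s≤s (count-mono-< y∈xs qy ¬py)
    ... | yes p | no ¬q  = contradiction (P⇒Q p) ¬q
    ... | no  _ | yes _  = m≤n⇒m≤1+n (count-mono-< y∈xs qy ¬py)
    ... | no  _ | no  _  = count-mono-< y∈xs qy ¬py

lex-<ʳ : ∀ K {g g′ l l′} → g′ ≤ g → l′ < l → g′ * K + l′ < g * K + l
lex-<ʳ K g′≤g l′<l = +-mono-≤-< (*-monoˡ-≤ K g′≤g) l′<l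

lex-<ˡ : ∀ K {g g′ l l′} → g′ < g → l′ < l + K → g′ * K + l′ < g * K + l
lex-<ˡ K {g} {g′} {l} {l′} g′<g l′<l+K = begin-strict
  g′ * K + l′       <⟨ +-monoʳ-< (g′ * K) l′<l+K ⟩
  g′ * K + (l + K)  ≡⟨ cong (g′ * K +_) (+-comm l K) ⟩
  g′ * K + (K + l)  ≡⟨ sym (+-assoc (g′ * K) K l) ⟩
  g′ * K + K + l    ≡⟨ cong (_+ l) (+-comm (g′ * K) K) ⟩
  suc g′ * K + l    ≤⟨ +-monoˡ-≤ l (*-monoˡ-≤ K g′<g) ⟩
  g * K + l         ∎
  where open ≤-Reasoning

infix 4 _≟ᶠ_
_≟ᶠ_ : DecidableEquality Fm
atom p ≟ᶠ atom q with p Data.Nat.≟ q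
... | yes refl = yes refl
... | no p≢q   = no λ { refl → p≢q refl }
¬' A ≟ᶠ ¬' B with A ≟ᶠ B
... | yes refl = yes refl
... | no A≢B   = no λ { refl → A≢B refl }
(A ∧' B) ≟ᶠ (C ∧' D) with A ≟ᶠ C | B ≟ᶠ D
... | yes refl | yes refl = yes refl
... | no A≢C   | _        = no λ { refl → A≢C refl }
... | _        | no B≢D   = no λ { refl → B≢D refl }
□ A ≟ᶠ □ B with A ≟ᶠ B
... | yes refl = yes refl
... | no A≢B   = no λ { refl → A≢B refl }
⟦ A ⟧ B ≟ᶠ ⟦ C ⟧ D with A ≟ᶠ C | B ≟ᶠ D
... | yes refl | yes refl = yes refl
... | no A≢C   | _        = no λ { refl → A≢C refl }
... | _        | no B≢D   = no λ { refl → B≢D refl }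
atom _  ≟ᶠ ¬' _    = no λ ()
atom _  ≟ᶠ _ ∧' _  = no λ ()
atom _  ≟ᶠ □ _     = no λ ()
atom _  ≟ᶠ ⟦ _ ⟧ _ = no λ ()
¬' _    ≟ᶠ atom _  = no λ ()
¬' _    ≟ᶠ _ ∧' _  = no λ ()
¬' _    ≟ᶠ □ _     = no λ ()
¬' _    ≟ᶠ ⟦ _ ⟧ _ = no λ ()
_ ∧' _  ≟ᶠ atom _  = no λ ()
_ ∧' _  ≟ᶠ ¬' _    = no λ ()
_ ∧' _  ≟ᶠ □ _     = no λ ()
_ ∧' _  ≟ᶠ ⟦ _ ⟧ _ = no λ ()
□ _     ≟ᶠ atom _  = no λ ()
□ _     ≟ᶠ ¬' _    = no λ ()
□ _     ≟ᶠ _ ∧' _  = no λ ()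
□ _     ≟ᶠ ⟦ _ ⟧ _ = no λ ()
⟦ _ ⟧ _ ≟ᶠ atom _  = no λ ()
⟦ _ ⟧ _ ≟ᶠ ¬' _    = no λ ()
⟦ _ ⟧ _ ≟ᶠ _ ∧' _  = no λ ()
⟦ _ ⟧ _ ≟ᶠ □ _     = no λ ()

infix 4 _≟ᵃ_
_≟ᵃ_ : DecidableEquality Ann
_≟ᵃ_ = ≡-dec _≟ᶠ_

size : Fm → ℕ
size (atom _)  = 1
size (¬' A)    = suc (size A)
size (A ∧' B)  = suc (size A + size B)
size (□ A)     = suc (size A)
size (⟦ A ⟧ B) = suc (suc (size A + size B))

annSize : Ann → ℕ
annSize []      = 0
annSize (A ∷ α) = suc (size A + annSize α)

annSize-∷ʳ : ∀ α A → annSize (α ∷ʳ A) ≡ annSize α + suc (size A)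
annSize-∷ʳ []      A = cong suc (+-identityʳ (size A))
annSize-∷ʳ (B ∷ α) A =
  cong suc (trans (cong (size B +_) (annSize-∷ʳ α A)) (sym (+-assoc (size B) (annSize α) _)))

annSize-split : ∀ pre C suf → annSize pre + suc (size C) ≤ annSize (pre ++ C ∷ suf)
annSize-split []        C suf = s≤s (m≤m+n (size C) (annSize suf))
annSize-split (B ∷ pre) C suf =
  s≤s (≤-trans (≤-reflexive (+-assoc (size B) (annSize pre) _)) (+-monoʳ-≤ (size B) (annSize-split pre C suf)))

annSize+size-< : ∀ α {a b n} → b < a → annSize α + a ≤ n → annSize α + b < n
annSize+size-< α b<a le = <-≤-trans (+-monoʳ-< (annSize α) b<a) le

annSize-⟦⟧ : ∀ α A B → annSize (α ∷ʳ A) + size B < annSize α + size (⟦ A ⟧ B)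
annSize-⟦⟧ α A B = begin-strict
  annSize (α ∷ʳ A) + size B               ≡⟨ cong (_+ size B) (annSize-∷ʳ α A) ⟩
  annSize α + suc (size A) + size B       ≡⟨ +-assoc (annSize α) (suc (size A)) (size B) ⟩
  annSize α + suc (size A + size B)       <⟨ +-monoʳ-< (annSize α) (n<1+n _) ⟩
  annSize α + size (⟦ A ⟧ B)              ∎
  where open ≤-Reasoning

subformulas : Fm → List Fm
subformulas (atom p)  = [ atom p ]
subformulas (¬' A)    = ¬' A ∷ subformulas A
subformulas (A ∧' B)  = A ∧' B ∷ subformulas A ++ subformulas B
subformulas (□ A)     = □ A ∷ subformulas A
subformulas (⟦ A ⟧ B) = ⟦ A ⟧ B ∷ subformulas A ++ subformulas B

A∈subformulas : ∀ A → A ∈ subformulas A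
A∈subformulas (atom _)  = here refl
A∈subformulas (¬' _)    = here refl
A∈subformulas (_ ∧' _)  = here refl
A∈subformulas (□ _)     = here refl
A∈subformulas (⟦ _ ⟧ _) = here refl

subformulas-trans : ∀ {A B C} → B ∈ subformulas C → A ∈ subformulas B → A ∈ subformulas C
subformulas-trans {C = atom _}  (here refl) A∈B = A∈B
subformulas-trans {C = ¬' _}    (here refl) A∈B = A∈B
subformulas-trans {C = ¬' C}    (there B∈C) A∈B = there (subformulas-trans B∈C A∈B)
subformulas-trans {C = _ ∧' _}  (here refl) A∈B = A∈B
subformulas-trans {C = C ∧' D}  (there B∈) A∈B with ∈-++⁻ (subformulas C) B∈
... | inj₁ B∈C = there (∈-++⁺ˡ (subformulas-trans B∈C A∈B))
... | inj₂ B∈D = there (∈-++⁺ʳ (subformulas C) (subformulas-trans B∈D A∈B))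
subformulas-trans {C = □ _}     (here refl) A∈B = A∈B
subformulas-trans {C = □ C}     (there B∈C) A∈B = there (subformulas-trans B∈C A∈B)
subformulas-trans {C = ⟦ _ ⟧ _} (here refl) A∈B = A∈B
subformulas-trans {C = ⟦ C ⟧ D} (there B∈) A∈B with ∈-++⁻ (subformulas C) B∈
... | inj₁ B∈C = there (∈-++⁺ˡ (subformulas-trans B∈C A∈B))
... | inj₂ B∈D = there (∈-++⁺ʳ (subformulas C) (subformulas-trans B∈D A∈B))

subformula-¬ : ∀ {A C} → ¬' A ∈ subformulas C → A ∈ subformulas C
subformula-¬ {A} m = subformulas-trans m (there (A∈subformulas A))

subformula-∧ˡ : ∀ {A B C} → A ∧' B ∈ subformulas C → A ∈ subformulas C
subformula-∧ˡ {A} m = subformulas-trans m (there (∈-++⁺ˡ (A∈subformulas A)))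

subformula-∧ʳ : ∀ {A B C} → A ∧' B ∈ subformulas C → B ∈ subformulas C
subformula-∧ʳ {A} {B} m = subformulas-trans m (there (∈-++⁺ʳ (subformulas A) (A∈subformulas B)))

subformula-□ : ∀ {A C} → □ A ∈ subformulas C → A ∈ subformulas C
subformula-□ {A} m = subformulas-trans m (there (A∈subformulas A))

subformula-⟦⟧ˡ : ∀ {A B C} → ⟦ A ⟧ B ∈ subformulas C → A ∈ subformulas C
subformula-⟦⟧ˡ {A} m = subformulas-trans m (there (∈-++⁺ˡ (A∈subformulas A)))

subformula-⟦⟧ʳ : ∀ {A B C} → ⟦ A ⟧ B ∈ subformulas C → B ∈ subformulas C
subformula-⟦⟧ʳ {A} {B} m = subformulas-trans m (there (∈-++⁺ʳ (subformulas A) (A∈subformulas B)))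

annDepth : Fm → ℕ
annDepth (atom _)  = 0
annDepth (¬' A)    = annDepth A
annDepth (A ∧' B)  = annDepth A ⊔ annDepth B
annDepth (□ A)     = annDepth A
annDepth (⟦ A ⟧ B) = suc (annDepth A ⊔ annDepth B)

updates : Model → Ann → Model
updates M []      = M
updates M (A ∷ α) = updates (update M A) α

origin : ∀ M α → W (updates M α) → W M
origin M []      u = u
origin M (A ∷ α) u = proj₁ (origin (update M A) α u)

snocWorld : ∀ M α A (u : W (updates M α)) → Sat (updates M α) u A → W (updates M (α ∷ʳ A))
snocWorld M []      A u h = u , h
snocWorld M (B ∷ α) A u h = snocWorld (update M B) α A u h

origin-snocWorld : ∀ M α A u h → origin M (α ∷ʳ A) (snocWorld M α A u h) ≡ origin M α u
origin-snocWorld M []      A u h = refl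
origin-snocWorld M (B ∷ α) A u h = cong proj₁ (origin-snocWorld (update M B) α A u h)

Sat-snocWorld : ∀ M α A u h B →
                Sat (updates M (α ∷ʳ A)) (snocWorld M α A u h) B ≡ Sat (update (updates M α) A) (u , h) B
Sat-snocWorld M []      A u h B = refl
Sat-snocWorld M (C ∷ α) A u h B = Sat-snocWorld (update M C) α A u h B

prefixWorld : ∀ M pre C suf → W (updates M (pre ++ C ∷ suf)) → Σ (W (updates M pre)) λ w → Sat (updates M pre) w C
prefixWorld M []        C suf v = origin (update M C) suf v
prefixWorld M (B ∷ pre) C suf v = prefixWorld (update M B) pre C suf v

origin-prefixWorld : ∀ M pre C suf v →
                     origin M pre (proj₁ (prefixWorld M pre C suf v)) ≡ origin M (pre ++ C ∷ suf) v
origin-prefixWorld M []        C suf v = refl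
origin-prefixWorld M (B ∷ pre) C suf v = cong proj₁ (origin-prefixWorld (update M B) pre C suf v)

V-updates : ∀ M α p u → V (updates M α) p u ≡ V M p (origin M α u)
V-updates M []      p u = refl
V-updates M (A ∷ α) p u = V-updates (update M A) α p u

updates-universal : ∀ M → (∀ u v → _∼_ M u v) → ∀ α u v → _∼_ (updates M α) u v
updates-universal M univ []      u v = univ u v
updates-universal M univ (A ∷ α) u v = updates-universal (update M A) (λ u v → univ (proj₁ u) (proj₁ v)) α u v

-- Items, tracked sequents and saturation

data Side : Set where
  L R : Side

side : Side → Seq → List Fm
side L = ant
side R = scd

_≟ˢ_ : DecidableEquality Side
L ≟ˢ L = yes refl
L ≟ˢ R = no λ ()
R ≟ˢ L = no λ ()
R ≟ˢ R = yes refl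

-- comp α: a component labelled α is present; occ α s A: A occurs on side s of that component.
data Item : Set where
  comp : Ann → Item
  occ  : Ann → Side → Fm → Item

labelOf : Item → Ann
labelOf (comp α)    = α
labelOf (occ α _ _) = α

_≟ⁱ_ : DecidableEquality Item
comp α ≟ⁱ comp β with α ≟ᵃ β
... | yes refl = yes refl
... | no α≢β   = no λ { refl → α≢β refl }
occ α s A ≟ⁱ occ β t B with α ≟ᵃ β | s ≟ˢ t | A ≟ᶠ B
... | yes refl | yes refl | yes refl = yes refl
... | no α≢β   | _        | _        = no λ { refl → α≢β refl }
... | _        | no s≢t   | _        = no λ { refl → s≢t refl }
... | _        | _        | no A≢B   = no λ { refl → A≢B refl }
comp _ ≟ⁱ occ _ _ _ = no λ ()
occ _ _ _ ≟ⁱ comp _ = no λ ()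

infix 4 _∈ᶜ_ _∈ᶜ?_ _∈ᵗ_ _∈ᵗ?_

_∈ᶜ_ : Item → Comp → Set
comp α    ∈ᶜ c = label c ≡ α
occ α s A ∈ᶜ c = label c ≡ α × A ∈ side s (seqt c)

_∈ᶜ?_ : ∀ t c → Dec (t ∈ᶜ c)
comp α    ∈ᶜ? c = label c ≟ᵃ α
occ α s A ∈ᶜ? c = (label c ≟ᵃ α) ×-dec Any.any? (A ≟ᶠ_) (side s (seqt c))

-- A dynamic sequent together with the items whose principal formula a rule has already
-- deleted from it; such spent items still count as present.
record Tracked : Set where
  constructor tracked
  field
    comps : DS
    spent : List Item
open Tracked
_∈ᵗ_ : Item → Tracked → Set
t ∈ᵗ X = Any (t ∈ᶜ_) (comps X) ⊎ t ∈ spent X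

_∈ᵗ?_ : ∀ t X → Dec (t ∈ᵗ X)
t ∈ᵗ? X = any? (t ∈ᶜ?_) (comps X) ⊎-dec Any.any? (t ≟ⁱ_) (spent X)

State : Set
State = List Tracked

erase : State → DHS
erase = map comps

-- The items whose rule deletes the principal formula; only these can become spent.
Consuming : Item → Set
Consuming (comp _)            = ⊥
Consuming (occ _ _ (atom _))  = ⊥
Consuming (occ _ _ (¬' _))    = ⊤
Consuming (occ _ _ (_ ∧' _))  = ⊤
Consuming (occ _ L (□ _))     = ⊥
Consuming (occ _ R (□ _))     = ⊤
Consuming (occ _ _ (⟦ _ ⟧ _)) = ⊤

refutedAnnouncement : Ann × Fm × Ann → Item
refutedAnnouncement (pre , C , _) = occ pre R C

-- Y holds what a premise of L□₂ / L□₃ for □ A at α, applied against the root of Y, adds: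
-- A at α, or some announcement of α refuted where it is made.
BoxPropagated : Ann → Fm → Tracked → Set
BoxPropagated α A Y = occ α L A ∈ᵗ Y ⊎ Any (λ q → refutedAnnouncement q ∈ᵗ Y) (splits α)
boxPropagated? : ∀ α A Y → Dec (BoxPropagated α A Y)
boxPropagated? α A Y = (occ α L A ∈ᵗ? Y) ⊎-dec any? (λ q → refutedAnnouncement q ∈ᵗ? Y) (splits α)

Reached : Item → Tracked → Set
Reached t Z = comp (labelOf t) ∈ᵗ Z × t ∈ᵗ Z

reached? : ∀ t Z → Dec (Reached t Z)
reached? t Z = (comp (labelOf t) ∈ᵗ? Z) ×-dec (t ∈ᵗ? Z)

rootPropagated? : ∀ α A Y → Dec (comp [] ∈ᵗ Y → BoxPropagated α A Y)
rootPropagated? α A Y = (comp [] ∈ᵗ? Y) →-dec boxPropagated? α A Y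

-- No backward rule with principal item t is needed any more: what it adds (for a branching
-- rule, what one of its premises adds) is already present.
Saturated : State → Tracked → Item → Set
Saturated S X (comp α)              = ForInitLast α λ β A → comp β ∈ᵗ X × occ β L A ∈ᵗ X
Saturated S X (occ α s (atom p))    = ForInitLast α λ β A → comp β ∈ᵗ X → occ β s (atom p) ∈ᵗ X
Saturated S X (occ α L (¬' A))      = occ α R A ∈ᵗ X
Saturated S X (occ α R (¬' A))      = occ α L A ∈ᵗ X
Saturated S X (occ α L (A ∧' B))    = occ α L A ∈ᵗ X × occ α L B ∈ᵗ X
Saturated S X (occ α R (A ∧' B))    = occ α R A ∈ᵗ X ⊎ occ α R B ∈ᵗ X
Saturated S X (occ α L (□ A))       = occ α L A ∈ᵗ X × All (λ Y → comp [] ∈ᵗ Y → BoxPropagated α A Y) S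
Saturated S X (occ α R (□ A))       = Any (Reached (occ α R A)) S
Saturated S X (occ α L (⟦ A ⟧ B))   = occ α R A ∈ᵗ X ⊎ occ (α ∷ʳ A) L B ∈ᵗ X
Saturated S X (occ α R (⟦ A ⟧ B))   = occ α L A ∈ᵗ X × occ (α ∷ʳ A) R B ∈ᵗ X

saturated? : ∀ S X t → Dec (Saturated S X t)
saturated? S X (comp α)            = forInitLast? α λ β A → (comp β ∈ᵗ? X) ×-dec (occ β L A ∈ᵗ? X)
saturated? S X (occ α s (atom p))  = forInitLast? α λ β A → (comp β ∈ᵗ? X) →-dec (occ β s (atom p) ∈ᵗ? X)
saturated? S X (occ α L (¬' A))    = occ α R A ∈ᵗ? X
saturated? S X (occ α R (¬' A))    = occ α L A ∈ᵗ? X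
saturated? S X (occ α L (A ∧' B))  = (occ α L A ∈ᵗ? X) ×-dec (occ α L B ∈ᵗ? X)
saturated? S X (occ α R (A ∧' B))  = (occ α R A ∈ᵗ? X) ⊎-dec (occ α R B ∈ᵗ? X)
saturated? S X (occ α L (□ A))     =
  (occ α L A ∈ᵗ? X) ×-dec all? (rootPropagated? α A) S
saturated? S X (occ α R (□ A))     = any? (reached? (occ α R A)) S
saturated? S X (occ α L (⟦ A ⟧ B)) = (occ α R A ∈ᵗ? X) ⊎-dec (occ (α ∷ʳ A) L B ∈ᵗ? X)
saturated? S X (occ α R (⟦ A ⟧ B)) = (occ α L A ∈ᵗ? X) ×-dec (occ (α ∷ʳ A) R B ∈ᵗ? X)

data IsAtom : Fm → Set where
  is-atom : ∀ p → IsAtom (atom p)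

isAtom? : Decidable IsAtom
isAtom? (atom p)  = yes (is-atom p)
isAtom? (¬' _)    = no λ ()
isAtom? (_ ∧' _)  = no λ ()
isAtom? (□ _)     = no λ ()
isAtom? (⟦ _ ⟧ _) = no λ ()

IsAxiom : Comp → Set
IsAxiom c = Any (λ A → IsAtom A × A ∈ scd (seqt c)) (ant (seqt c))

isAxiom? : Decidable IsAxiom
isAxiom? c = any? (λ A → isAtom? A ×-dec Any.any? (A ≟ᶠ_) (scd (seqt c))) (ant (seqt c))

infix 4 _⊆ᵗ_ _⊑_ _≋_

_⊆ᵗ_ : Tracked → Tracked → Set
X ⊆ᵗ X′ = ∀ {t} → t ∈ᵗ X → t ∈ᵗ X′

⊆ᵗ-trans : ∀ {X Y Z} → X ⊆ᵗ Y → Y ⊆ᵗ Z → X ⊆ᵗ Z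
⊆ᵗ-trans X⊆Y Y⊆Z m = Y⊆Z (X⊆Y m)

_⊑_ : State → State → Set
S ⊑ S′ = ∀ {Z} → Z ∈ S → Any (Z ⊆ᵗ_) S′

⊑-trans : ∀ {S₁ S₂ S₃} → S₁ ⊑ S₂ → S₂ ⊑ S₃ → S₁ ⊑ S₃
⊑-trans S₁⊑S₂ S₂⊑S₃ Z∈S₁ with Z₂ , Z₂∈S₂ , Z⊆Z₂ ← find (S₁⊑S₂ Z∈S₁) = Any.map (⊆ᵗ-trans Z⊆Z₂) (S₂⊑S₃ Z₂∈S₂)

⊑-replace : ∀ {S X X′ Rs} → S ↭ X ∷ Rs → X ⊆ᵗ X′ → S ⊑ X′ ∷ Rs
⊑-replace σ X⊆X′ Z∈S with Any-resp-↭ σ Z∈S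
... | here refl = here X⊆X′
... | there Z∈Rs = there (Any.map (λ { refl m → m }) Z∈Rs)

⊑-spawn : ∀ {S X X′ Z Rs} → S ↭ X ∷ Rs → X ⊆ᵗ X′ → S ⊑ X′ ∷ Z ∷ Rs
⊑-spawn σ X⊆X′ = ⊑-trans (⊑-replace σ X⊆X′) λ
  { (here refl) → here (λ m → m)
  ; (there m)   → there (there (Any.map (λ { refl m → m }) m)) }

reached-mono : ∀ {S S′} t → S ⊑ S′ → Any (Reached t) S → Any (Reached t) S′
reached-mono t S⊑S′ r with Z , Z∈S , (c , u) ← find r = Any.map (λ Z⊆ → Z⊆ c , Z⊆ u) (S⊑S′ Z∈S)

saturated-mono : ∀ {S S′ X X′} t → Consuming t → X ⊆ᵗ X′ → S ⊑ S′ → Saturated S X t → Saturated S′ X′ t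
saturated-mono (occ α L (¬' A))    _ X⊆ _    sat            = X⊆ sat
saturated-mono (occ α R (¬' A))    _ X⊆ _    sat            = X⊆ sat
saturated-mono (occ α L (A ∧' B))  _ X⊆ _    (satA , satB)  = X⊆ satA , X⊆ satB
saturated-mono (occ α R (A ∧' B))  _ X⊆ _    (inj₁ satA)    = inj₁ (X⊆ satA)
saturated-mono (occ α R (A ∧' B))  _ X⊆ _    (inj₂ satB)    = inj₂ (X⊆ satB)
saturated-mono (occ α R (□ A))     _ _   S⊑S′ sat           = reached-mono (occ α R A) S⊑S′ sat
saturated-mono (occ α L (⟦ A ⟧ B)) _ X⊆ _    (inj₁ satA)    = inj₁ (X⊆ satA)
saturated-mono (occ α L (⟦ A ⟧ B)) _ X⊆ _    (inj₂ satB)    = inj₂ (X⊆ satB)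
saturated-mono (occ α R (⟦ A ⟧ B)) _ X⊆ _    (satA , satB)  = X⊆ satA , X⊆ satB

rootWeight : Ann → ℕ
rootWeight []      = 1
rootWeight (_ ∷ _) = 0

rootCount : DS → ℕ
rootCount cs = sum (map (rootWeight ∘ label) cs)

rootCount-↭ : ∀ {cs cs′} → cs ↭ cs′ → rootCount cs ≡ rootCount cs′
rootCount-↭ p = sum-↭ (map⁺ (rootWeight ∘ label) p)

rootCount-cons≤1 : ∀ α {n} → (α ≡ [] → n ≡ 0) → n ≤ 1 → rootWeight α + n ≤ 1
rootCount-cons≤1 []      noRoot _   = subst (λ n → 1 + n ≤ 1) (sym (noRoot refl)) ≤-refl
rootCount-cons≤1 (_ ∷ _) _      n≤1 = n≤1

rootCount-absent : ∀ cs → ¬ Any (comp [] ∈ᶜ_) cs → rootCount cs ≡ 0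
rootCount-absent []                  _     = refl
rootCount-absent (([] ▸ _) ∷ cs)     noRoot = contradiction (here refl) noRoot
rootCount-absent ((_ ∷ _ ▸ _) ∷ cs) noRoot = rootCount-absent cs (noRoot ∘ there)

rootCount-pos : ∀ {P : Comp → Set} {cs} → Any (λ c → label c ≡ [] × P c) cs → 0 < rootCount cs
rootCount-pos {cs = (_ ▸ _) ∷ _}  (here (refl , _)) = s≤s z≤n
rootCount-pos {cs = c ∷ cs}       (there m)         =
  ≤-trans (rootCount-pos m) (m≤n+m (rootCount cs) (rootWeight (label c)))

root-unique : ∀ {P Q : Comp → Set} cs → rootCount cs ≤ 1 →
              Any (λ c → label c ≡ [] × P c) cs → Any (λ c → label c ≡ [] × Q c) cs → Any (λ c → P c × Q c) cs
root-unique ((_ ▸ _) ∷ cs) _        (here (refl , p)) (here (_ , q))    = here (p , q)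
root-unique ((_ ▸ _) ∷ cs) (s≤s ≤0) (here (refl , _)) (there m)         =
  contradiction (≤-trans (rootCount-pos m) ≤0) λ ()
root-unique ((_ ▸ _) ∷ cs) (s≤s ≤0) (there m)         (here (refl , _)) =
  contradiction (≤-trans (rootCount-pos m) ≤0) λ ()
root-unique (c ∷ cs)       ≤1       (there m₁)        (there m₂)        =
  there (root-unique cs (≤-trans (m≤n+m (rootCount cs) (rootWeight (label c))) ≤1) m₁ m₂)

data _≋_ : DS → DS → Set where
  ≋-perm  : ∀ {cs cs′} → cs ↭ cs′ → cs ≋ cs′
  ≋-head  : ∀ {α M M′ N N′ cs} → M ↭ M′ → N ↭ N′ → (α ▸ M ⇒ N) ∷ cs ≋ (α ▸ M′ ⇒ N′) ∷ cs
  ≋-trans : ∀ {cs₁ cs₂ cs₃} → cs₁ ≋ cs₂ → cs₂ ≋ cs₃ → cs₁ ≋ cs₃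

≋-sym : ∀ {cs cs′} → cs ≋ cs′ → cs′ ≋ cs
≋-sym (≋-perm p)     = ≋-perm (↭-sym p)
≋-sym (≋-head p q)   = ≋-head (↭-sym p) (↭-sym q)
≋-sym (≋-trans p q)  = ≋-trans (≋-sym q) (≋-sym p)

⊢-resp-≋ : ∀ {cs cs′ G} → cs ≋ cs′ → ⊢ (cs ∷ G) → ⊢ (cs′ ∷ G)
⊢-resp-≋ (≋-perm p)    d = exDS p d
⊢-resp-≋ (≋-head p q)  d = exSeq p q d
⊢-resp-≋ (≋-trans p q) d = ⊢-resp-≋ q (⊢-resp-≋ p d)

⊢-resp-≋₂ : ∀ {cs cs′ ds G} → cs ≋ cs′ → ⊢ (ds ∷ cs ∷ G) → ⊢ (ds ∷ cs′ ∷ G)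
⊢-resp-≋₂ e d = exDHS (swap _ _ ↭-refl) (⊢-resp-≋ e (exDHS (swap _ _ ↭-refl) d))

Any-∈ᶜ-resp-≋ : ∀ {cs cs′} t → cs ≋ cs′ → Any (t ∈ᶜ_) cs → Any (t ∈ᶜ_) cs′
Any-∈ᶜ-resp-≋ t (≋-perm p)    m = Any-resp-↭ p m
Any-∈ᶜ-resp-≋ t (≋-head p q)  (there m) = there m
Any-∈ᶜ-resp-≋ (comp α)    (≋-head p q) (here eq)       = here eq
Any-∈ᶜ-resp-≋ (occ α L A) (≋-head p q) (here (eq , m)) = here (eq , ∈-resp-↭ p m)
Any-∈ᶜ-resp-≋ (occ α R A) (≋-head p q) (here (eq , m)) = here (eq , ∈-resp-↭ q m)
Any-∈ᶜ-resp-≋ t (≋-trans p q) m = Any-∈ᶜ-resp-≋ t q (Any-∈ᶜ-resp-≋ t p m)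

rootCount-≋ : ∀ {cs cs′} → cs ≋ cs′ → rootCount cs ≡ rootCount cs′
rootCount-≋ (≋-perm p)    = rootCount-↭ p
rootCount-≋ (≋-head p q)  = refl
rootCount-≋ (≋-trans p q) = trans (rootCount-≋ p) (rootCount-≋ q)

length-≋ : ∀ {cs cs′} → cs ≋ cs′ → length cs ≡ length cs′
length-≋ (≋-perm p)    = ↭-length p
length-≋ (≋-head p q)  = refl
length-≋ (≋-trans p q) = trans (length-≋ p) (length-≋ q)

conclude : ∀ {S X Rs cs} → S ↭ X ∷ Rs → comps X ≋ cs → ⊢ (cs ∷ erase Rs) → ⊢ (erase S)
conclude σ e d = exDHS (↭-sym (map⁺ comps σ)) (⊢-resp-≋ (≋-sym e) d)

conclude₂ : ∀ {S X Y Rs cs ds} → S ↭ X ∷ Y ∷ Rs → comps X ≋ cs → comps Y ≋ ds →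
            ⊢ (cs ∷ ds ∷ erase Rs) → ⊢ (erase S)
conclude₂ σ ex ey d = conclude σ ex (⊢-resp-≋₂ (≋-sym ey) d)

addSide : Side → Fm → Comp → Comp
addSide L A (α ▸ M ⇒ N) = α ▸ A ∷ M ⇒ N
addSide R A (α ▸ M ⇒ N) = α ▸ M ⇒ A ∷ N

∈ᶜ-addSide⁺ : ∀ s A c {t} → t ∈ᶜ c → t ∈ᶜ addSide s A c
∈ᶜ-addSide⁺ L A c {comp _}    m       = m
∈ᶜ-addSide⁺ L A c {occ _ L _} (e , m) = e , there m
∈ᶜ-addSide⁺ L A c {occ _ R _} m       = m
∈ᶜ-addSide⁺ R A c {comp _}    m       = m
∈ᶜ-addSide⁺ R A c {occ _ L _} m       = m
∈ᶜ-addSide⁺ R A c {occ _ R _} (e , m) = e , there m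

∈ᶜ-addSide⁻ : ∀ s A c {t} → t ∈ᶜ addSide s A c → t ∈ᶜ c ⊎ t ≡ occ (label c) s A
∈ᶜ-addSide⁻ L A c {comp _}    m                   = inj₁ m
∈ᶜ-addSide⁻ L A c {occ _ L _} (refl , here refl)  = inj₂ refl
∈ᶜ-addSide⁻ L A c {occ _ L _} (e , there m)       = inj₁ (e , m)
∈ᶜ-addSide⁻ L A c {occ _ R _} m                   = inj₁ m
∈ᶜ-addSide⁻ R A c {comp _}    m                   = inj₁ m
∈ᶜ-addSide⁻ R A c {occ _ L _} m                   = inj₁ m
∈ᶜ-addSide⁻ R A c {occ _ R _} (refl , here refl)  = inj₂ refl
∈ᶜ-addSide⁻ R A c {occ _ R _} (e , there m)       = inj₁ (e , m)

label-addSide : ∀ s A c → label (addSide s A c) ≡ label c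
label-addSide L A (α ▸ _ ⇒ _) = refl
label-addSide R A (α ▸ _ ⇒ _) = refl

occ∈ᶜaddSide : ∀ s A c → occ (label c) s A ∈ᶜ addSide s A c
occ∈ᶜaddSide L A (α ▸ _ ⇒ _) = refl , here refl
occ∈ᶜaddSide R A (α ▸ _ ⇒ _) = refl , here refl

itemsOf : Comp → List Item
itemsOf (α ▸ M ⇒ N) = comp α ∷ map (occ α L) M ++ map (occ α R) N

∈ᶜ⇒∈itemsOf : ∀ c {t} → t ∈ᶜ c → t ∈ itemsOf c
∈ᶜ⇒∈itemsOf (α ▸ M ⇒ N) {comp _}    refl       = here refl
∈ᶜ⇒∈itemsOf (α ▸ M ⇒ N) {occ _ L _} (refl , m) = there (∈-++⁺ˡ (∈-map⁺ (occ α L) m))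
∈ᶜ⇒∈itemsOf (α ▸ M ⇒ N) {occ _ R _} (refl , m) = there (∈-++⁺ʳ (map (occ α L) M) (∈-map⁺ (occ α R) m))

∈itemsOf⇒∈ᶜ : ∀ c {t} → t ∈ itemsOf c → t ∈ᶜ c
∈itemsOf⇒∈ᶜ (α ▸ M ⇒ N) (here refl) = refl
∈itemsOf⇒∈ᶜ (α ▸ M ⇒ N) (there m) with ∈-++⁻ (map (occ α L) M) m
... | inj₁ m′ with _ , A∈M , refl ← ∈-map⁻ (occ α L) m′ = refl , A∈M
... | inj₂ m′ with _ , A∈N , refl ← ∈-map⁻ (occ α R) m′ = refl , A∈N

focus-comp : ∀ {α cs} → Any (comp α ∈ᶜ_) cs → ∃[ M ] ∃[ N ] ∃[ cs′ ] cs ≋ (α ▸ M ⇒ N) ∷ cs′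
focus-comp m with (_ ▸ M ⇒ N) , refl , cs′ , π ← extract m = M , N , cs′ , ≋-perm π

focus-occ : ∀ {α A cs} s → Any (occ α s A ∈ᶜ_) cs → ∃[ M ] ∃[ N ] ∃[ cs′ ] cs ≋ addSide s A (α ▸ M ⇒ N) ∷ cs′
focus-occ L m with (_ ▸ M ⇒ N) , (refl , A∈M) , cs′ , π ← extract m with M′ , ρ ← ∈⇒↭ A∈M =
  M′ , N , cs′ , ≋-trans (≋-perm π) (≋-head ρ ↭-refl)
focus-occ R m with (_ ▸ M ⇒ N) , (refl , A∈N) , cs′ , π ← extract m with N′ , ρ ← ∈⇒↭ A∈N =
  M , N′ , cs′ , ≋-trans (≋-perm π) (≋-head ↭-refl ρ)

focus-after : ∀ {β c cs cs′} → cs ≋ c ∷ cs′ → Any (comp β ∈ᶜ_) cs′ →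
              ∃[ M ] ∃[ N ] ∃[ cs″ ] cs ≋ c ∷ (β ▸ M ⇒ N) ∷ cs″
focus-after {c = c} e m with (_ ▸ M ⇒ N) , refl , cs″ , π ← extract m = M , N , cs″ , ≋-trans e (≋-perm (prep c π))

focus-before : ∀ {β c cs cs′} → cs ≋ c ∷ cs′ → label c ≢ β → Any (comp β ∈ᶜ_) cs →
               ∃[ M ] ∃[ N ] ∃[ cs″ ] cs ≋ (β ▸ M ⇒ N) ∷ c ∷ cs″
focus-before e c≢β m with Any-∈ᶜ-resp-≋ _ e m
... | here c≡β = contradiction c≡β c≢β
... | there m′ with M , N , cs″ , e′ ← focus-after e m′ = M , N , cs″ , ≋-trans e′ (≋-perm (swap _ _ ↭-refl))

record Change (X X′ : Tracked) (new spentNow : List Item) : Set where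
  field
    grows       : X ⊆ᵗ X′
    only-new    : ∀ {t} → t ∈ᵗ X′ → t ∈ᵗ X ⊎ t ∈ new
    spent-≡     : spent X′ ≡ spentNow ++ spent X
    rootCount≤1 : rootCount (comps X) ≤ 1 → rootCount (comps X′) ≤ 1
    nonempty    : 0 < length (comps X) → 0 < length (comps X′)

change-≋ : ∀ {X cs} → comps X ≋ cs → Change X (tracked cs (spent X)) [] []
change-≋ e = record
  { grows       = λ { (inj₁ m) → inj₁ (Any-∈ᶜ-resp-≋ _ e m) ; (inj₂ m) → inj₂ m }
  ; only-new    = λ { (inj₁ m) → inj₁ (inj₁ (Any-∈ᶜ-resp-≋ _ (≋-sym e) m)) ; (inj₂ m) → inj₁ (inj₂ m) }
  ; spent-≡     = refl
  ; rootCount≤1 = subst (_≤ 1) (rootCount-≋ e)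
  ; nonempty    = subst (0 <_) (length-≋ e)
  }

infixl 5 _⨾_

_⨾_ : ∀ {X Y Z n₁ h₁ n₂ h₂} → Change X Y n₁ h₁ → Change Y Z n₂ h₂ → Change X Z (n₁ ++ n₂) (h₂ ++ h₁)
_⨾_ {X} {n₁ = n₁} {h₁} {h₂ = h₂} c d = record
  { grows       = ⊆ᵗ-trans (Change.grows c) (Change.grows d)
  ; only-new    = back
  ; spent-≡     = trans (Change.spent-≡ d)
                        (trans (cong (h₂ ++_) (Change.spent-≡ c)) (sym (++-assoc h₂ h₁ (spent X))))
  ; rootCount≤1 = Change.rootCount≤1 d ∘ Change.rootCount≤1 c
  ; nonempty    = Change.nonempty d ∘ Change.nonempty c
  }
  where
  back : ∀ {t} → t ∈ᵗ _ → t ∈ᵗ X ⊎ t ∈ n₁ ++ _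
  back m with Change.only-new d m
  ... | inj₂ m₂ = inj₂ (∈-++⁺ʳ n₁ m₂)
  ... | inj₁ m₁ with Change.only-new c m₁
  ...   | inj₁ m₀ = inj₁ m₀
  ...   | inj₂ m₂ = inj₂ (∈-++⁺ˡ m₂)

change-add : ∀ s A c cs h → Change (tracked (c ∷ cs) h) (tracked (addSide s A c ∷ cs) h) [ occ (label c) s A ] []
change-add s A c cs h = record
  { grows       = λ { (inj₁ (here m)) → inj₁ (here (∈ᶜ-addSide⁺ s A c m)) ; (inj₁ (there m)) → inj₁ (there m)
                    ; (inj₂ m) → inj₂ m }
  ; only-new    = back
  ; spent-≡     = refl
  ; rootCount≤1 = subst (λ α → rootWeight α + rootCount cs ≤ 1) (sym (label-addSide s A c))
  ; nonempty    = λ _ → s≤s z≤n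
  }
  where
  back : ∀ {t} → t ∈ᵗ tracked (addSide s A c ∷ cs) h → t ∈ᵗ tracked (c ∷ cs) h ⊎ t ∈ [ occ (label c) s A ]
  back (inj₁ (there m)) = inj₁ (inj₁ (there m))
  back (inj₂ m)         = inj₁ (inj₂ m)
  back (inj₁ (here m)) with ∈ᶜ-addSide⁻ s A c m
  ... | inj₁ m′   = inj₁ (inj₁ (here m′))
  ... | inj₂ refl = inj₂ (here refl)

change-spend : ∀ s A c cs h →
               Change (tracked (addSide s A c ∷ cs) h) (tracked (c ∷ cs) (occ (label c) s A ∷ h))
                      [] [ occ (label c) s A ]
change-spend s A c cs h = record
  { grows       = forth
  ; only-new    = λ { (inj₁ (here m))     → inj₁ (inj₁ (here (∈ᶜ-addSide⁺ s A c m)))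
                    ; (inj₁ (there m))    → inj₁ (inj₁ (there m))
                    ; (inj₂ (here refl))  → inj₁ (inj₁ (here (occ∈ᶜaddSide s A c)))
                    ; (inj₂ (there m))    → inj₁ (inj₂ m) }
  ; spent-≡     = refl
  ; rootCount≤1 = subst (λ α → rootWeight α + rootCount cs ≤ 1) (label-addSide s A c)
  ; nonempty    = λ _ → s≤s z≤n
  }
  where
  forth : tracked (addSide s A c ∷ cs) h ⊆ᵗ tracked (c ∷ cs) (occ (label c) s A ∷ h)
  forth (inj₁ (there m)) = inj₁ (there m)
  forth (inj₂ m)         = inj₂ (there m)
  forth (inj₁ (here m)) with ∈ᶜ-addSide⁻ s A c m
  ... | inj₁ m′   = inj₁ (here m′)
  ... | inj₂ refl = inj₂ (here refl)

change-cons : ∀ c cs h → (label c ≡ [] → rootCount cs ≡ 0) →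
              Change (tracked cs h) (tracked (c ∷ cs) h) (itemsOf c) []
change-cons c cs h noRoot = record
  { grows       = λ { (inj₁ m) → inj₁ (there m) ; (inj₂ m) → inj₂ m }
  ; only-new    = λ { (inj₁ (here m))  → inj₂ (∈ᶜ⇒∈itemsOf c m)
                    ; (inj₁ (there m)) → inj₁ (inj₁ m)
                    ; (inj₂ m)         → inj₁ (inj₂ m) }
  ; spent-≡     = refl
  ; rootCount≤1 = rootCount-cons≤1 (label c) noRoot
  ; nonempty    = λ _ → s≤s z≤n
  }

≋-change : ∀ {X cs X′ new spentNow} → comps X ≋ cs → Change (tracked cs (spent X)) X′ new spentNow →
           Change X X′ new spentNow
≋-change {spentNow = spentNow} e ch = subst (Change _ _ _) (++-identityʳ spentNow) (change-≋ e ⨾ ch)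

change-add₂ : ∀ s A c d cs h →
              Change (tracked (c ∷ d ∷ cs) h) (tracked (c ∷ addSide s A d ∷ cs) h) [ occ (label d) s A ] []
change-add₂ s A c d cs h =
  change-≋ (≋-perm (swap c d ↭-refl)) ⨾ change-add s A d (c ∷ cs) h ⨾
  change-≋ (≋-perm (swap (addSide s A d) c ↭-refl))

change-insert₂ : ∀ d c cs h → label d ≢ [] → Change (tracked (c ∷ cs) h) (tracked (c ∷ d ∷ cs) h) (itemsOf d) []
change-insert₂ d c cs h nonroot =
  subst (λ new → Change (tracked (c ∷ cs) h) (tracked (c ∷ d ∷ cs) h) new []) (++-identityʳ (itemsOf d))
        (change-cons d (c ∷ cs) h (λ eq → contradiction eq nonroot) ⨾ change-≋ (≋-perm (swap d c ↭-refl)))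

pattern occ₁ = here (refl , here refl)
pattern occ₂ = there (here (refl , here refl))

module Completeness (A₀ : Fm) where

  -- Relevant items

  Sub : Fm → Set
  Sub A = A ∈ subformulas A₀

  d₀ : ℕ
  d₀ = annDepth A₀

  -- The announcement in position i of a label is made under k + i earlier ones.
  Admissible : ℕ → Ann → Set
  Admissible k []      = ⊤
  Admissible k (C ∷ α) = suc (k + annDepth C) ≤ d₀ × Sub C × Admissible (suc k) α

  data Relevant : Item → Set where
    relevantComp : ∀ {α} → Admissible 0 α → length α ≤ d₀ → Relevant (comp α)
    relevantOcc  : ∀ {α s A} → Admissible 0 α → Sub A → length α + annDepth A ≤ d₀ → Relevant (occ α s A)

  admissible-split : ∀ k pre C suf → Admissible k (pre ++ C ∷ suf) →
                     suc (k + length pre + annDepth C) ≤ d₀ × Sub C × Admissible k pre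
  admissible-split k [] C suf (bound , subC , _) =
    subst (λ n → suc (n + annDepth C) ≤ d₀) (sym (+-identityʳ k)) bound , subC , tt
  admissible-split k (B ∷ pre) C suf (boundB , subB , adm)
    with bound , subC , admPre ← admissible-split (suc k) pre C suf adm =
    subst (λ n → suc (n + annDepth C) ≤ d₀) (sym (+-suc k (length pre))) bound , subC , boundB , subB , admPre

  admissible-∷ʳ : ∀ k α A → Admissible k α → suc (k + length α + annDepth A) ≤ d₀ → Sub A →
                  Admissible k (α ∷ʳ A)
  admissible-∷ʳ k []      A _ bound subA =
    subst (λ n → suc (n + annDepth A) ≤ d₀) (+-identityʳ k) bound , subA , tt
  admissible-∷ʳ k (B ∷ α) A (boundB , subB , adm) bound subA =
    boundB , subB ,
    admissible-∷ʳ (suc k) α A adm (subst (λ n → suc (n + annDepth A) ≤ d₀) (+-suc k (length α)) bound) subA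

  admissible⇒Sub : ∀ k α → Admissible k α → All Sub α
  admissible⇒Sub k []      _               = []
  admissible⇒Sub k (C ∷ α) (_ , subC , adm) = subC ∷ admissible⇒Sub (suc k) α adm

  relevant⇒comp : ∀ {α s A} → Relevant (occ α s A) → Relevant (comp α)
  relevant⇒comp {α} {A = A} (relevantOcc adm _ bound) =
    relevantComp adm (≤-trans (m≤m+n (length α) (annDepth A)) bound)

  relevant-sub : ∀ {α s A B} s′ → Sub B → annDepth B ≤ annDepth A → Relevant (occ α s A) → Relevant (occ α s′ B)
  relevant-sub {α} _ subB B≤A (relevantOcc adm _ bound) =
    relevantOcc adm subB (≤-trans (+-monoʳ-≤ (length α) B≤A) bound)

  subOf : ∀ {α s A} → Relevant (occ α s A) → Sub A
  subOf (relevantOcc _ subA _) = subA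

  relevant-¬ : ∀ {α s A} s′ → Relevant (occ α s (¬' A)) → Relevant (occ α s′ A)
  relevant-¬ s′ r = relevant-sub s′ (subformula-¬ (subOf r)) ≤-refl r

  relevant-∧ˡ : ∀ {α s A B} s′ → Relevant (occ α s (A ∧' B)) → Relevant (occ α s′ A)
  relevant-∧ˡ {A = A} {B} s′ r = relevant-sub s′ (subformula-∧ˡ (subOf r)) (m≤m⊔n (annDepth A) (annDepth B)) r

  relevant-∧ʳ : ∀ {α s A B} s′ → Relevant (occ α s (A ∧' B)) → Relevant (occ α s′ B)
  relevant-∧ʳ {A = A} {B} s′ r = relevant-sub s′ (subformula-∧ʳ (subOf r)) (m≤n⊔m (annDepth A) (annDepth B)) r

  relevant-□ : ∀ {α s A} s′ → Relevant (occ α s (□ A)) → Relevant (occ α s′ A)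
  relevant-□ s′ r = relevant-sub s′ (subformula-□ (subOf r)) ≤-refl r

  relevant-⟦⟧ˡ : ∀ {α s A B} s′ → Relevant (occ α s (⟦ A ⟧ B)) → Relevant (occ α s′ A)
  relevant-⟦⟧ˡ {A = A} {B} s′ r =
    relevant-sub s′ (subformula-⟦⟧ˡ (subOf r)) (m≤n⇒m≤1+n (m≤m⊔n (annDepth A) (annDepth B))) r

  relevant-⟦⟧ʳ : ∀ {α s A B} s′ → Relevant (occ α s (⟦ A ⟧ B)) → Relevant (occ (α ∷ʳ A) s′ B)
  relevant-⟦⟧ʳ {α} {A = A} {B} s′ (relevantOcc adm sub bound) =
    relevantOcc (admissible-∷ʳ 0 α A adm (within (m≤m⊔n (annDepth A) (annDepth B))) (subformula-⟦⟧ˡ sub))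
                (subformula-⟦⟧ʳ sub)
                (subst (λ n → n + annDepth B ≤ d₀) (sym (length-∷ʳ α A))
                       (within (m≤n⊔m (annDepth A) (annDepth B))))
    where
    within : ∀ {n} → n ≤ annDepth A ⊔ annDepth B → suc (length α + n) ≤ d₀
    within {n} n≤ = begin
      suc (length α + n)                        ≡⟨ sym (+-suc (length α) n) ⟩
      length α + suc n                          ≤⟨ +-monoʳ-≤ (length α) (s≤s n≤) ⟩
      length α + suc (annDepth A ⊔ annDepth B)  ≤⟨ bound ⟩
      d₀                                        ∎
      where open ≤-Reasoning

  relevant-split : ∀ {s A} pre C suf → Relevant (occ (pre ++ C ∷ suf) s A) → Relevant (occ pre R C)
  relevant-split pre C suf (relevantOcc adm _ _) with bound , subC , admPre ← admissible-split 0 pre C suf adm =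
    relevantOcc admPre subC (<⇒≤ bound)

  relevant-init : ∀ {α A} → Relevant (comp (α ∷ʳ A)) → Relevant (occ α L A)
  relevant-init {α} {A} (relevantComp adm _) with bound , subA , admα ← admissible-split 0 α A [] adm =
    relevantOcc admα subA (<⇒≤ bound)

  relevant-init-atom : ∀ {α A s p} → Relevant (occ (α ∷ʳ A) s (atom p)) → Relevant (occ α s (atom p))
  relevant-init-atom {α} {A} (relevantOcc adm subp bound) with _ , _ , admα ← admissible-split 0 α A [] adm =
    relevantOcc admα subp (≤-trans (+-monoˡ-≤ 0 (≤-trans (n≤1+n (length α)) (≤-reflexive (sym (length-∷ʳ α A)))))
                                   bound)

  itemsAt : Ann → List Item
  itemsAt α = comp α ∷ concatMap (λ A → occ α L A ∷ occ α R A ∷ []) (subformulas A₀)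

  relevantItems : List Item
  relevantItems = concatMap itemsAt (listsOver (subformulas A₀) d₀)

  ∈-relevantItems : ∀ {t} → Relevant t → t ∈ relevantItems
  ∈-relevantItems {comp α} (relevantComp adm bound) =
    ∈-concatMap⁺′ itemsAt (∈-listsOver d₀ α (admissible⇒Sub 0 α adm) bound) (here refl)
  ∈-relevantItems {occ α s A} (relevantOcc adm subA bound) =
    ∈-concatMap⁺′ itemsAt (∈-listsOver d₀ α (admissible⇒Sub 0 α adm) (≤-trans (m≤m+n _ _) bound))
      (there (∈-concatMap⁺′ (λ A → occ α L A ∷ occ α R A ∷ []) subA (occ∈ s)))
    where
    occ∈ : ∀ s → occ α s A ∈ occ α L A ∷ occ α R A ∷ []
    occ∈ L = here refl
    occ∈ R = there (here refl)

  -- Termination measure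

  missing : Tracked → ℕ
  missing X = count (λ t → ¬? (t ∈ᵗ? X)) relevantItems

  unreached : State → ℕ
  unreached S = count (λ t → ¬? (any? (reached? t) S)) relevantItems

  K : ℕ
  K = suc (length relevantItems)

  -- Lexicographic in (unreached S, total missing): only R□ adds a sequent, which raises the
  -- second component by less than K but reaches a new item.
  μ : State → ℕ
  μ S = unreached S * K + sum (map missing S)

  missing-mono : ∀ {X X′} → X ⊆ᵗ X′ → missing X′ ≤ missing X
  missing-mono {X} {X′} X⊆X′ =
    count-mono (λ t → ¬? (t ∈ᵗ? X′)) (λ t → ¬? (t ∈ᵗ? X)) (λ u∉X′ u∈X → u∉X′ (X⊆X′ u∈X)) relevantItems

  missing-< : ∀ {X X′ u} → X ⊆ᵗ X′ → Relevant u → ¬ u ∈ᵗ X → u ∈ᵗ X′ → missing X′ < missing X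
  missing-< {X} {X′} X⊆X′ r u∉X u∈X′ =
    count-mono-< (λ t → ¬? (t ∈ᵗ? X′)) (λ t → ¬? (t ∈ᵗ? X)) (λ t∉X′ t∈X → t∉X′ (X⊆X′ t∈X))
                 (∈-relevantItems r) u∉X (λ u∉X′ → u∉X′ u∈X′)

  unreached-mono : ∀ {S S′} → S ⊑ S′ → unreached S′ ≤ unreached S
  unreached-mono {S} {S′} S⊑S′ =
    count-mono (λ t → ¬? (any? (reached? t) S′)) (λ t → ¬? (any? (reached? t) S))
               (λ {t} t∉S′ t∈S → t∉S′ (reached-mono t S⊑S′ t∈S)) relevantItems

  unreached-< : ∀ {S S′ u} → S ⊑ S′ → Relevant u → ¬ Any (Reached u) S → Any (Reached u) S′ →
                unreached S′ < unreached S
  unreached-< {S} {S′} S⊑S′ r u∉S u∈S′ =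
    count-mono-< (λ t → ¬? (any? (reached? t) S′)) (λ t → ¬? (any? (reached? t) S))
                 (λ {t} t∉S′ t∈S → t∉S′ (reached-mono t S⊑S′ t∈S)) (∈-relevantItems r) u∉S (λ u∉S′ → u∉S′ u∈S′)

  sum-missing-↭ : ∀ {S S′} → S ↭ S′ → sum (map missing S) ≡ sum (map missing S′)
  sum-missing-↭ σ = sum-↭ (map⁺ missing σ)

  μ-replace : ∀ {S X X′ Rs u} → S ↭ X ∷ Rs → X ⊆ᵗ X′ → Relevant u → ¬ u ∈ᵗ X → u ∈ᵗ X′ → μ (X′ ∷ Rs) < μ S
  μ-replace {S} {X} {X′} {Rs} σ X⊆X′ r u∉X u∈X′ = lex-<ʳ K (unreached-mono (⊑-replace σ X⊆X′)) (begin-strict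
    missing X′ + sum (map missing Rs)  <⟨ +-monoˡ-< _ (missing-< X⊆X′ r u∉X u∈X′) ⟩
    missing X + sum (map missing Rs)   ≡⟨ sum-missing-↭ (↭-sym σ) ⟩
    sum (map missing S)                ∎)
    where open ≤-Reasoning

  μ-spawn : ∀ {S X X′ Z Rs u} → S ↭ X ∷ Rs → X ⊆ᵗ X′ → Relevant u → ¬ Any (Reached u) S → Reached u Z →
            μ (X′ ∷ Z ∷ Rs) < μ S
  μ-spawn {S} {X} {X′} {Z} {Rs} σ X⊆X′ r u∉S u∈Z =
    lex-<ˡ K (unreached-< (⊑-spawn σ X⊆X′) r u∉S (there (here u∈Z))) (begin-strict
      missing X′ + (missing Z + sum (map missing Rs))            ≤⟨ +-monoˡ-≤ _ (missing-mono X⊆X′) ⟩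
      missing X + (missing Z + sum (map missing Rs))             ≤⟨ +-monoʳ-≤ (missing X) (+-monoˡ-≤ _ missing≤) ⟩
      missing X + (length relevantItems + sum (map missing Rs))  ≡⟨ +-comm-middle ⟩
      sum (map missing (X ∷ Rs)) + length relevantItems          <⟨ +-monoʳ-< _ (n<1+n _) ⟩
      sum (map missing (X ∷ Rs)) + K                             ≡⟨ cong (_+ K) (sum-missing-↭ (↭-sym σ)) ⟩
      sum (map missing S) + K                                    ∎)
    where
    open ≤-Reasoning
    missing≤ : missing Z ≤ length relevantItems
    missing≤ = count≤length _ relevantItems
    +-comm-middle : missing X + (length relevantItems + sum (map missing Rs)) ≡
                    missing X + sum (map missing Rs) + length relevantItems
    +-comm-middle = trans (cong (missing X +_) (+-comm (length relevantItems) _)) (sym (+-assoc (missing X) _ _))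

  record Invariant (S : State) (X : Tracked) : Set where
    field
      spent-saturated : All (λ t → Consuming t × Saturated S X t) (spent X)
      rootCount≤1     : rootCount (comps X) ≤ 1   -- so a root atom on both sides forms an axiom
      relevant        : ∀ {t} → t ∈ᵗ X → Relevant t
      nonempty        : 0 < length (comps X)

  StateInvariant : State → Set
  StateInvariant S = All (Invariant S) S × Any (occ [] R A₀ ∈ᵗ_) S

  invariant-mono : ∀ {S S′ X} → S ⊑ S′ → Invariant S X → Invariant S′ X
  invariant-mono S⊑S′ inv = record
    { spent-saturated = All.map (λ { (c , sat) → c , saturated-mono _ c (λ m → m) S⊑S′ sat }) spent-saturated
    ; rootCount≤1     = rootCount≤1
    ; relevant        = relevant
    ; nonempty        = nonempty
    }
    where open Invariant inv

  invariant-change : ∀ {S S′ X X′ new spentNow} → S ⊑ S′ → Invariant S X → Change X X′ new spentNow →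
                     All Relevant new → All (λ t → Consuming t × Saturated S′ X′ t) spentNow → Invariant S′ X′
  invariant-change {S′ = S′} {X′ = X′} S⊑S′ inv ch new-relevant now-saturated = record
    { spent-saturated = subst (All (λ t → Consuming t × Saturated S′ X′ t)) (sym spent-≡)
        (All-++⁺ now-saturated (All.map (λ { (c , sat) → c , saturated-mono _ c grows S⊑S′ sat })
                                        (Invariant.spent-saturated inv)))
    ; rootCount≤1     = rootCount≤1 (Invariant.rootCount≤1 inv)
    ; relevant        = λ m → [ Invariant.relevant inv , All.lookup new-relevant ]′ (only-new m)
    ; nonempty        = nonempty (Invariant.nonempty inv)
    }
    where open Change ch

  goal-⊑ : ∀ {S S′} → S ⊑ S′ → Any (occ [] R A₀ ∈ᵗ_) S → Any (occ [] R A₀ ∈ᵗ_) S′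
  goal-⊑ S⊑S′ g with Z , Z∈S , m ← find g = Any.map (λ Z⊆ → Z⊆ m) (S⊑S′ Z∈S)

  Gains : Tracked → Tracked → Set
  Gains X X′ = ∃[ u ] Relevant u × ¬ u ∈ᵗ X × u ∈ᵗ X′

  gains-either : ∀ {X X′ t₁ t₂} → Relevant t₁ → Relevant t₂ → t₁ ∈ᵗ X′ → t₂ ∈ᵗ X′ → ¬ (t₁ ∈ᵗ X × t₂ ∈ᵗ X) →
                 Gains X X′
  gains-either {X} {t₁ = t₁} r₁ r₂ m₁ m₂ ¬both with t₁ ∈ᵗ? X
  ... | yes t₁∈X = _ , r₂ , (λ t₂∈X → ¬both (t₁∈X , t₂∈X)) , m₂
  ... | no  t₁∉X = _ , r₁ , t₁∉X , m₁

  advance : ∀ {S X Rs X′ new spentNow} → StateInvariant S → S ↭ X ∷ Rs → Change X X′ new spentNow →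
            All Relevant new → All (λ t → Consuming t × Saturated (X′ ∷ Rs) X′ t) spentNow → Gains X X′ →
            StateInvariant (X′ ∷ Rs) × μ (X′ ∷ Rs) < μ S
  advance {S} {Rs = Rs} {X′} (invs , goal) σ ch new-relevant now-saturated (_ , r , u∉X , u∈X′)
    with invX ∷ invRs ← All-resp-↭ σ invs =
    (invariant-change S⊑ invX ch new-relevant now-saturated ∷ All.map (invariant-mono S⊑) invRs , goal-⊑ S⊑ goal) ,
    μ-replace σ (Change.grows ch) r u∉X u∈X′
    where
    S⊑ : S ⊑ X′ ∷ Rs
    S⊑ = ⊑-replace σ (Change.grows ch)

  Below : State → Set
  Below S = ∀ S′ → StateInvariant S′ → μ S′ < μ S → ⊢ (erase S′)

  invariantAt : ∀ {S X Rs} → StateInvariant S → S ↭ X ∷ Rs → Invariant S X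
  invariantAt (invs , _) σ = All.lookup (All-resp-↭ σ invs) (here refl)

  relevantAt : ∀ {S X Rs cs} → StateInvariant S → S ↭ X ∷ Rs → comps X ≋ cs → ∀ t → Any (t ∈ᶜ_) cs → Relevant t
  relevantAt inv σ e _ m = Invariant.relevant (invariantAt inv σ) (inj₁ (Any-∈ᶜ-resp-≋ _ (≋-sym e) m))

  descend : ∀ {S X Rs cs X′ new spentNow} → Below S → StateInvariant S → S ↭ X ∷ Rs → comps X ≋ cs →
            Change (tracked cs (spent X)) X′ new spentNow → All Relevant new →
            All (λ t → Consuming t × Saturated (X′ ∷ Rs) X′ t) spentNow → Gains X X′ → ⊢ (comps X′ ∷ erase Rs)
  descend below inv σ e ch new-relevant now-saturated gains
    with inv′ , μ< ← advance inv σ (≋-change e ch) new-relevant now-saturated gains = below _ inv′ μ<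

  -- Backward rule applications

  expand-L¬ : ∀ {S X Rs α A M N cs} → Below S → StateInvariant S → S ↭ X ∷ Rs →
              comps X ≋ (α ▸ ¬' A ∷ M ⇒ N) ∷ cs → ¬ occ α R A ∈ᵗ X → ⊢ (erase S)
  expand-L¬ {α = α} {A} {M} {N} {cs} below inv σ e A∉X =
    conclude σ e (L¬ (descend below inv σ e
      (change-spend L (¬' A) (α ▸ M ⇒ N) cs _ ⨾ change-add R A (α ▸ M ⇒ N) cs _)
      (rA ∷ []) ((tt , inj₁ occ₁) ∷ []) (_ , rA , A∉X , inj₁ occ₁)))
    where
    rA : Relevant (occ α R A)
    rA = relevant-¬ R (relevantAt inv σ e (occ α L (¬' A)) occ₁)

  expand-R¬ : ∀ {S X Rs α A M N cs} → Below S → StateInvariant S → S ↭ X ∷ Rs →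
              comps X ≋ (α ▸ M ⇒ ¬' A ∷ N) ∷ cs → ¬ occ α L A ∈ᵗ X → ⊢ (erase S)
  expand-R¬ {α = α} {A} {M} {N} {cs} below inv σ e A∉X =
    conclude σ e (R¬ (descend below inv σ e
      (change-spend R (¬' A) (α ▸ M ⇒ N) cs _ ⨾ change-add L A (α ▸ M ⇒ N) cs _)
      (rA ∷ []) ((tt , inj₁ occ₁) ∷ []) (_ , rA , A∉X , inj₁ occ₁)))
    where
    rA : Relevant (occ α L A)
    rA = relevant-¬ L (relevantAt inv σ e (occ α R (¬' A)) occ₁)

  expand-L∧ : ∀ {S X Rs α A B M N cs} → Below S → StateInvariant S → S ↭ X ∷ Rs →
              comps X ≋ (α ▸ A ∧' B ∷ M ⇒ N) ∷ cs → ¬ (occ α L A ∈ᵗ X × occ α L B ∈ᵗ X) → ⊢ (erase S)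
  expand-L∧ {X = X} {α = α} {A} {B} {M} {N} {cs} below inv σ e ¬both =
    conclude σ e (L∧ (descend below inv σ e
      (change-spend L (A ∧' B) (α ▸ M ⇒ N) cs _ ⨾ change-add L B (α ▸ M ⇒ N) cs _ ⨾
       change-add L A (α ▸ B ∷ M ⇒ N) cs _)
      (rB ∷ rA ∷ []) ((tt , (inj₁ occ₁ , B∈)) ∷ []) (gains-either rA rB (inj₁ occ₁) B∈ ¬both)))
    where
    r : Relevant (occ α L (A ∧' B))
    r = relevantAt inv σ e (occ α L (A ∧' B)) occ₁
    rA : Relevant (occ α L A)
    rA = relevant-∧ˡ L r
    rB : Relevant (occ α L B)
    rB = relevant-∧ʳ L r
    B∈ : occ α L B ∈ᵗ tracked ((α ▸ A ∷ B ∷ M ⇒ N) ∷ cs) (occ α L (A ∧' B) ∷ spent X)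
    B∈ = inj₁ (here (refl , there (here refl)))

  expand-R∧ : ∀ {S X Rs α A B M N cs} → Below S → StateInvariant S → S ↭ X ∷ Rs →
              comps X ≋ (α ▸ M ⇒ A ∧' B ∷ N) ∷ cs → ¬ (occ α R A ∈ᵗ X ⊎ occ α R B ∈ᵗ X) → ⊢ (erase S)
  expand-R∧ {α = α} {A} {B} {M} {N} {cs} below inv σ e ¬either =
    conclude σ e (R∧
      (descend below inv σ e (change-spend R (A ∧' B) (α ▸ M ⇒ N) cs _ ⨾ change-add R A (α ▸ M ⇒ N) cs _)
               (rA ∷ []) ((tt , inj₁ (inj₁ occ₁)) ∷ []) (_ , rA , ¬either ∘ inj₁ , inj₁ occ₁))
      (descend below inv σ e (change-spend R (A ∧' B) (α ▸ M ⇒ N) cs _ ⨾ change-add R B (α ▸ M ⇒ N) cs _)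
               (rB ∷ []) ((tt , inj₂ (inj₁ occ₁)) ∷ []) (_ , rB , ¬either ∘ inj₂ , inj₁ occ₁)))
    where
    r : Relevant (occ α R (A ∧' B))
    r = relevantAt inv σ e (occ α R (A ∧' B)) occ₁
    rA : Relevant (occ α R A)
    rA = relevant-∧ˡ R r
    rB : Relevant (occ α R B)
    rB = relevant-∧ʳ R r

  expand-L□₁ : ∀ {S X Rs α A M N cs} → Below S → StateInvariant S → S ↭ X ∷ Rs →
               comps X ≋ (α ▸ □ A ∷ M ⇒ N) ∷ cs → ¬ occ α L A ∈ᵗ X → ⊢ (erase S)
  expand-L□₁ {α = α} {A} {M} {N} {cs} below inv σ e A∉X =
    conclude σ e (L□₁ (descend below inv σ e
      (change-add L A (α ▸ □ A ∷ M ⇒ N) cs _ ⨾ change-≋ (≋-head (swap A (□ A) ↭-refl) ↭-refl))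
      (rA ∷ []) [] (_ , rA , A∉X , inj₁ (here (refl , there (here refl))))))
    where
    rA : Relevant (occ α L A)
    rA = relevant-□ L (relevantAt inv σ e (occ α L (□ A)) occ₁)

  expand-L⟦⟧ : ∀ {S X Rs α A B M N M′ N′ cs} → Below S → StateInvariant S → S ↭ X ∷ Rs →
               comps X ≋ (α ▸ ⟦ A ⟧ B ∷ M ⇒ N) ∷ (α ∷ʳ A ▸ M′ ⇒ N′) ∷ cs →
               ¬ (occ α R A ∈ᵗ X ⊎ occ (α ∷ʳ A) L B ∈ᵗ X) → ⊢ (erase S)
  expand-L⟦⟧ {α = α} {A} {B} {M} {N} {M′} {N′} {cs} below inv σ e ¬either =
    conclude σ e (L[]
      (descend below inv σ e (change-spend L (⟦ A ⟧ B) c _ _ ⨾ change-add R A c _ _)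
               (rA ∷ []) ((tt , inj₁ (inj₁ occ₁)) ∷ []) (_ , rA , ¬either ∘ inj₁ , inj₁ occ₁))
      (descend below inv σ e (change-spend L (⟦ A ⟧ B) c _ _ ⨾ change-add₂ L B c (α ∷ʳ A ▸ M′ ⇒ N′) cs _)
               (rB ∷ []) ((tt , inj₂ (inj₁ occ₂)) ∷ []) (_ , rB , ¬either ∘ inj₂ , inj₁ occ₂)))
    where
    c : Comp
    c = α ▸ M ⇒ N
    r : Relevant (occ α L (⟦ A ⟧ B))
    r = relevantAt inv σ e (occ α L (⟦ A ⟧ B)) occ₁
    rA : Relevant (occ α R A)
    rA = relevant-⟦⟧ˡ R r
    rB : Relevant (occ (α ∷ʳ A) L B)
    rB = relevant-⟦⟧ʳ L r

  expand-L⟦⟧-new : ∀ {S X Rs α A B M N cs} → Below S → StateInvariant S → S ↭ X ∷ Rs →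
                   comps X ≋ (α ▸ ⟦ A ⟧ B ∷ M ⇒ N) ∷ cs → All (λ c → label c ≢ α ∷ʳ A) cs →
                   ¬ (occ α R A ∈ᵗ X ⊎ occ (α ∷ʳ A) L B ∈ᵗ X) → ⊢ (erase S)
  expand-L⟦⟧-new {α = α} {A} {B} {M} {N} {cs} below inv σ e fresh ¬either =
    conclude σ e (L[]new fresh
      (descend below inv σ e (change-spend L (⟦ A ⟧ B) c _ _ ⨾ change-add R A c _ _)
               (rA ∷ []) ((tt , inj₁ (inj₁ occ₁)) ∷ []) (_ , rA , ¬either ∘ inj₁ , inj₁ occ₁))
      (descend below inv σ e (change-spend L (⟦ A ⟧ B) c _ _ ⨾ change-insert₂ (α ∷ʳ A ▸ [ B ] ⇒ []) c cs _ ∷ʳ≢[])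
               (relevant⇒comp rB ∷ rB ∷ []) ((tt , inj₂ (inj₁ occ₂)) ∷ []) (_ , rB , ¬either ∘ inj₂ , inj₁ occ₂)))
    where
    c : Comp
    c = α ▸ M ⇒ N
    r : Relevant (occ α L (⟦ A ⟧ B))
    r = relevantAt inv σ e (occ α L (⟦ A ⟧ B)) occ₁
    rA : Relevant (occ α R A)
    rA = relevant-⟦⟧ˡ R r
    rB : Relevant (occ (α ∷ʳ A) L B)
    rB = relevant-⟦⟧ʳ L r

  expand-R⟦⟧ : ∀ {S X Rs α A B M N M′ N′ cs} → Below S → StateInvariant S → S ↭ X ∷ Rs →
               comps X ≋ (α ▸ M ⇒ ⟦ A ⟧ B ∷ N) ∷ (α ∷ʳ A ▸ M′ ⇒ N′) ∷ cs →
               ¬ (occ α L A ∈ᵗ X × occ (α ∷ʳ A) R B ∈ᵗ X) → ⊢ (erase S)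
  expand-R⟦⟧ {α = α} {A} {B} {M} {N} {M′} {N′} {cs} below inv σ e ¬both =
    conclude σ e (R[] (descend below inv σ e
      (change-spend R (⟦ A ⟧ B) c _ _ ⨾ change-add₂ R B c (α ∷ʳ A ▸ M′ ⇒ N′) cs _ ⨾ change-add L A c _ _)
      (rB ∷ rA ∷ []) ((tt , (inj₁ occ₁ , inj₁ occ₂)) ∷ []) (gains-either rA rB (inj₁ occ₁) (inj₁ occ₂) ¬both)))
    where
    c : Comp
    c = α ▸ M ⇒ N
    r : Relevant (occ α R (⟦ A ⟧ B))
    r = relevantAt inv σ e (occ α R (⟦ A ⟧ B)) occ₁
    rA : Relevant (occ α L A)
    rA = relevant-⟦⟧ˡ L r
    rB : Relevant (occ (α ∷ʳ A) R B)
    rB = relevant-⟦⟧ʳ R r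

  expand-R⟦⟧-new : ∀ {S X Rs α A B M N cs} → Below S → StateInvariant S → S ↭ X ∷ Rs →
                   comps X ≋ (α ▸ M ⇒ ⟦ A ⟧ B ∷ N) ∷ cs → All (λ c → label c ≢ α ∷ʳ A) cs →
                   ¬ (occ α L A ∈ᵗ X × occ (α ∷ʳ A) R B ∈ᵗ X) → ⊢ (erase S)
  expand-R⟦⟧-new {α = α} {A} {B} {M} {N} {cs} below inv σ e fresh ¬both =
    conclude σ e (R[]new fresh (descend below inv σ e
      (change-spend R (⟦ A ⟧ B) c _ _ ⨾ change-insert₂ (α ∷ʳ A ▸ [] ⇒ [ B ]) c cs _ ∷ʳ≢[] ⨾ change-add L A c _ _)
      (relevant⇒comp rB ∷ rB ∷ rA ∷ []) ((tt , (inj₁ occ₁ , inj₁ occ₂)) ∷ [])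
      (gains-either rA rB (inj₁ occ₁) (inj₁ occ₂) ¬both)))
    where
    c : Comp
    c = α ▸ M ⇒ N
    r : Relevant (occ α R (⟦ A ⟧ B))
    r = relevantAt inv σ e (occ α R (⟦ A ⟧ B)) occ₁
    rA : Relevant (occ α L A)
    rA = relevant-⟦⟧ˡ L r
    rB : Relevant (occ (α ∷ʳ A) R B)
    rB = relevant-⟦⟧ʳ R r

  expand-New : ∀ {S X Rs α A M N cs} → Below S → StateInvariant S → S ↭ X ∷ Rs →
               comps X ≋ (α ∷ʳ A ▸ M ⇒ N) ∷ cs → ¬ comp α ∈ᵗ X → ⊢ (erase S)
  expand-New {X = X} {α = α} {A} {M} {N} {cs} below inv σ e α∉X =
    conclude σ e (New (descend below inv σ e (change-cons (α ▸ [] ⇒ []) _ _ noRoot)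
      (rα ∷ []) [] (_ , rα , α∉X , inj₁ (here refl))))
    where
    rα : Relevant (comp α)
    rα = relevant⇒comp (relevant-init (relevantAt inv σ e (comp (α ∷ʳ A)) (here refl)))
    noRoot : α ≡ [] → rootCount ((α ∷ʳ A ▸ M ⇒ N) ∷ cs) ≡ 0
    noRoot refl = rootCount-absent _ λ m → α∉X (inj₁ (Any-∈ᶜ-resp-≋ (comp []) (≋-sym e) m))

  expand-Recall : ∀ {S X Rs α A M N M′ N′ cs} → Below S → StateInvariant S → S ↭ X ∷ Rs →
                  comps X ≋ (α ▸ M ⇒ N) ∷ (α ∷ʳ A ▸ M′ ⇒ N′) ∷ cs → ¬ occ α L A ∈ᵗ X → ⊢ (erase S)
  expand-Recall {α = α} {A} {M} {N} {M′} {N′} {cs} below inv σ e A∉X =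
    conclude σ e (Recall (descend below inv σ e (change-add L A (α ▸ M ⇒ N) _ _)
      (rA ∷ []) [] (_ , rA , A∉X , inj₁ occ₁)))
    where
    rA : Relevant (occ α L A)
    rA = relevant-init (relevantAt inv σ e (comp (α ∷ʳ A)) (there (here refl)))

  expand-Lat : ∀ {S X Rs α A p M N M′ N′ cs} → Below S → StateInvariant S → S ↭ X ∷ Rs →
               comps X ≋ (α ▸ M ⇒ N) ∷ (α ∷ʳ A ▸ atom p ∷ M′ ⇒ N′) ∷ cs → ¬ occ α L (atom p) ∈ᵗ X → ⊢ (erase S)
  expand-Lat {α = α} {A} {p} {M} {N} {M′} {N′} {cs} below inv σ e p∉X =
    conclude σ e (Lat (descend below inv σ e (change-add L (atom p) (α ▸ M ⇒ N) _ _)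
      (rp ∷ []) [] (_ , rp , p∉X , inj₁ occ₁)))
    where
    rp : Relevant (occ α L (atom p))
    rp = relevant-init-atom (relevantAt inv σ e (occ (α ∷ʳ A) L (atom p)) occ₂)

  expand-Rat : ∀ {S X Rs α A p M N M′ N′ cs} → Below S → StateInvariant S → S ↭ X ∷ Rs →
               comps X ≋ (α ▸ M ⇒ N) ∷ (α ∷ʳ A ▸ M′ ⇒ atom p ∷ N′) ∷ cs → ¬ occ α R (atom p) ∈ᵗ X → ⊢ (erase S)
  expand-Rat {α = α} {A} {p} {M} {N} {M′} {N′} {cs} below inv σ e p∉X =
    conclude σ e (Rat (descend below inv σ e (change-add R (atom p) (α ▸ M ⇒ N) _ _)
      (rp ∷ []) [] (_ , rp , p∉X , inj₁ occ₁)))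
    where
    rp : Relevant (occ α R (atom p))
    rp = relevant-init-atom (relevantAt inv σ e (occ (α ∷ʳ A) R (atom p)) occ₂)

  expand-L□₂ : ∀ {S X Y Rs A M N cs M′ N′ ds} → Below S → StateInvariant S → S ↭ X ∷ Y ∷ Rs →
               comps X ≋ ([] ▸ □ A ∷ M ⇒ N) ∷ cs → comps Y ≋ ([] ▸ M′ ⇒ N′) ∷ ds → ¬ occ [] L A ∈ᵗ Y →
               ⊢ (erase S)
  expand-L□₂ {X = X} {Y} {Rs} {A} {M} {N} {M′ = M′} {N′} {ds} below inv σ ex ey A∉Y =
    conclude₂ σ ex ey (L□₂ (exDHS (swap _ _ ↭-refl) (⊢-resp-≋₂ ex premise)))
    where
    rA : Relevant (occ [] L A)
    rA = relevant-□ L (relevantAt inv σ ex (occ [] L (□ A)) occ₁)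
    premise : ⊢ ((([] ▸ A ∷ M′ ⇒ N′) ∷ ds) ∷ comps X ∷ erase Rs)
    premise = descend below inv (↭-trans σ (swap X Y ↭-refl)) ey (change-add L A ([] ▸ M′ ⇒ N′) ds _)
                      (rA ∷ []) [] (_ , rA , A∉Y , inj₁ occ₁)

  expand-L□₃ : ∀ {S X Y Rs B Bs A M N cs M′ N′ ds} → Below S → StateInvariant S → S ↭ X ∷ Y ∷ Rs →
               comps X ≋ (B ∷ Bs ▸ □ A ∷ M ⇒ N) ∷ cs → comps Y ≋ ([] ▸ M′ ⇒ N′) ∷ ds →
               ¬ BoxPropagated (B ∷ Bs) A Y → ⊢ (erase S)
  expand-L□₃ {X = X} {Y} {Rs} {B} {Bs} {A} {M} {N} {cs} {M′} {N′} {ds} below inv σ ex ey ¬propagated =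
    conclude₂ (↭-trans σ (swap X Y ↭-refl)) ey ex (L□₃ {α = []} first middle last)
    where
    r : Relevant (occ (B ∷ Bs) L (□ A))
    r = relevantAt inv σ ex (occ (B ∷ Bs) L (□ A)) occ₁
    root : Comp
    root = [] ▸ M′ ⇒ N′

    premise : ∀ {Y′ new} → Change (tracked (root ∷ ds) (spent Y)) Y′ new [] → All Relevant new → Gains Y Y′ →
              ⊢ (comps Y′ ∷ ((B ∷ Bs ▸ □ A ∷ M ⇒ N) ∷ cs) ∷ erase Rs)
    premise ch new-relevant gains =
      ⊢-resp-≋₂ ex (descend below inv (↭-trans σ (swap X Y ↭-refl)) ey ch new-relevant [] gains)

    first : ⊢ ((([] ▸ M′ ⇒ B ∷ N′) ∷ ds) ∷ ((B ∷ Bs ▸ □ A ∷ M ⇒ N) ∷ cs) ∷ erase Rs)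
    first = premise (change-add R B root ds _) (rB ∷ []) (_ , rB , (λ m → ¬propagated (inj₂ (here m))) , inj₁ occ₁)
      where
      rB : Relevant (occ [] R B)
      rB = relevant-split [] B Bs r

    middle : ∀ pre C suf → B ∷ Bs ≡ pre ++ C ∷ suf → pre ≢ [] →
             ⊢ ((root ∷ (pre ▸ [] ⇒ [ C ]) ∷ ds) ∷ ((B ∷ Bs ▸ □ A ∷ M ⇒ N) ∷ cs) ∷ erase Rs)
    middle pre C suf β≡ pre≢[] =
      premise (change-insert₂ (pre ▸ [] ⇒ [ C ]) root ds _ pre≢[]) (relevant⇒comp rC ∷ rC ∷ [])
              (_ , rC , (λ m → ¬propagated (inj₂ (Any.map (λ { refl → m }) split∈))) , inj₁ occ₂)
      where
      rC : Relevant (occ pre R C)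
      rC = relevant-split pre C suf (subst (λ β → Relevant (occ β L (□ A))) β≡ r)
      split∈ : (pre , C , suf) ∈ splits (B ∷ Bs)
      split∈ = subst (λ β → (pre , C , suf) ∈ splits β) (sym β≡) (∈-splits⁺ pre C suf)

    last : ⊢ ((root ∷ (B ∷ Bs ▸ [ A ] ⇒ []) ∷ ds) ∷ ((B ∷ Bs ▸ □ A ∷ M ⇒ N) ∷ cs) ∷ erase Rs)
    last = premise (change-insert₂ (B ∷ Bs ▸ [ A ] ⇒ []) root ds _ (λ ())) (relevant⇒comp rA ∷ rA ∷ [])
                   (_ , rA , ¬propagated ∘ inj₁ , inj₁ occ₂)
      where
      rA : Relevant (occ (B ∷ Bs) L A)
      rA = relevant-□ L r

  fresh-invariant : ∀ {S α A} → Relevant (occ α R A) → Invariant S (tracked ((α ▸ [] ⇒ [ A ]) ∷ []) [])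
  fresh-invariant {α = α} {A} rA = record
    { spent-saturated = []
    ; rootCount≤1     = rootCount-cons≤1 α (λ _ → refl) z≤n
    ; relevant        = relevantZ
    ; nonempty        = s≤s z≤n
    }
    where
    relevantZ : ∀ {t} → t ∈ᵗ tracked ((α ▸ [] ⇒ [ A ]) ∷ []) [] → Relevant t
    relevantZ {comp _}    (inj₁ (here refl))               = relevant⇒comp rA
    relevantZ {occ _ R _} (inj₁ occ₁)                      = rA
    relevantZ {occ _ R _} (inj₁ (here (_ , there ())))
    relevantZ {occ _ L _} (inj₁ (here (_ , ())))
    relevantZ             (inj₁ (there ()))
    relevantZ             (inj₂ ())

  expand-R□ : ∀ {S X Rs α A M N cs} → Below S → StateInvariant S → S ↭ X ∷ Rs →
              comps X ≋ (α ▸ M ⇒ □ A ∷ N) ∷ cs → ¬ Any (Reached (occ α R A)) S → ⊢ (erase S)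
  expand-R□ {S} {X} {Rs} {α} {A} {M} {N} {cs} below inv@(invs , goal) σ e unreachedA
    with invX ∷ invRs ← All-resp-↭ σ invs =
    conclude σ e (R□ (below (X′ ∷ Z ∷ Rs) inv′ (μ-spawn σ (Change.grows ch) rA unreachedA reachedZ)))
    where
    rA : Relevant (occ α R A)
    rA = relevant-□ R (relevantAt inv σ e (occ α R (□ A)) occ₁)
    X′ Z : Tracked
    X′ = tracked ((α ▸ M ⇒ N) ∷ cs) (occ α R (□ A) ∷ spent X)
    Z = tracked ((α ▸ [] ⇒ [ A ]) ∷ []) []
    ch : Change X X′ [] [ occ α R (□ A) ]
    ch = ≋-change e (change-spend R (□ A) (α ▸ M ⇒ N) cs _)
    reachedZ : Reached (occ α R A) Z
    reachedZ = inj₁ (here refl) , inj₁ occ₁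
    S⊑ : S ⊑ X′ ∷ Z ∷ Rs
    S⊑ = ⊑-spawn σ (Change.grows ch)
    inv′ : StateInvariant (X′ ∷ Z ∷ Rs)
    inv′ = (invariant-change S⊑ invX ch [] ((tt , there (here reachedZ)) ∷ []) ∷ fresh-invariant rA ∷
            All.map (invariant-mono S⊑) invRs) , goal-⊑ S⊑ goal

  physical : ∀ {S X t} → Invariant S X → ¬ Consuming t → t ∈ᵗ X → Any (t ∈ᶜ_) (comps X)
  physical _   _          (inj₁ m) = m
  physical inv ¬consuming (inj₂ m) =
    contradiction (proj₁ (All.lookup (Invariant.spent-saturated inv) m)) ¬consuming

  expand-atom : ∀ {S X Rs α A p M N M′ N′ cs} s → Below S → StateInvariant S → S ↭ X ∷ Rs →
                comps X ≋ (α ▸ M ⇒ N) ∷ addSide s (atom p) (α ∷ʳ A ▸ M′ ⇒ N′) ∷ cs →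
                ¬ occ α s (atom p) ∈ᵗ X → ⊢ (erase S)
  expand-atom L = expand-Lat
  expand-atom R = expand-Rat

  expand-L□-across : ∀ {S X Y Rs A M N cs M′ N′ ds} α → Below S → StateInvariant S → S ↭ X ∷ Y ∷ Rs →
                     comps X ≋ (α ▸ □ A ∷ M ⇒ N) ∷ cs → comps Y ≋ ([] ▸ M′ ⇒ N′) ∷ ds →
                     ¬ BoxPropagated α A Y → ⊢ (erase S)
  expand-L□-across []       below inv σ ex ey ¬propagated = expand-L□₂ below inv σ ex ey (¬propagated ∘ inj₁)
  expand-L□-across (_ ∷ _)  below inv σ ex ey ¬propagated = expand-L□₃ below inv σ ex ey ¬propagated

  expand-L□-against : ∀ {S X Y Rs α A M N cs} → Below S → StateInvariant S → S ↭ X ∷ Y ∷ Rs →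
                      comps X ≋ (α ▸ □ A ∷ M ⇒ N) ∷ cs → ¬ (comp [] ∈ᵗ Y → BoxPropagated α A Y) → ⊢ (erase S)
  expand-L□-against {X = X} {Y} {α = α} below inv σ e ¬propagated with comp [] ∈ᵗ? Y
  ... | no noRoot = contradiction (λ root → contradiction root noRoot) ¬propagated
  ... | yes root
    with _ , _ , _ , ey ← focus-comp (physical (invariantAt inv (↭-trans σ (swap X Y ↭-refl))) (λ ()) root) =
    expand-L□-across α below inv σ e ey λ propagated → ¬propagated (λ _ → propagated)

  expand-L□ : ∀ {S X Rs α A M N cs} → Below S → StateInvariant S → S ↭ X ∷ Rs →
              comps X ≋ (α ▸ □ A ∷ M ⇒ N) ∷ cs → ¬ Saturated S X (occ α L (□ A)) → ⊢ (erase S)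
  expand-L□ {S} {X} {Rs} {α} {A} below inv σ e ¬sat with occ α L A ∈ᵗ? X
  ... | no A∉X = expand-L□₁ below inv σ e A∉X
  ... | yes A∈X with all? (rootPropagated? α A) Rs
  ...   | yes propagated = ⊥-elim (¬sat (A∈X , All-resp-↭ (↭-sym σ) ((λ _ → inj₁ A∈X) ∷ propagated)))
  ...   | no ¬propagated with extract (¬All⇒Any¬ (rootPropagated? α A) Rs ¬propagated)
  ...     | Y , ¬propagatedY , Rs′ , ρ = expand-L□-against below inv (↭-trans σ (prep X ρ)) e ¬propagatedY

  expand : ∀ {S X Rs} → Below S → StateInvariant S → S ↭ X ∷ Rs →
           ∀ t → Any (t ∈ᶜ_) (comps X) → ¬ Saturated S X t → ⊢ (erase S)
  expand {X = X} below inv σ (comp α) m ¬sat with ¬ForInitLast α ¬sat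
  ... | β , A , refl , ¬sat′ with focus-comp m
  ...   | _ , _ , _ , e with comp β ∈ᵗ? X
  ...     | no β∉X = expand-New below inv σ e β∉X
  ...     | yes β∈X with focus-before e (∷ʳ≢ β A) (physical (invariantAt inv σ) (λ ()) β∈X)
  ...       | _ , _ , _ , e′ = expand-Recall below inv σ e′ λ A∈X → ¬sat′ (β∈X , A∈X)
  expand {X = X} below inv σ (occ α s (atom p)) m ¬sat with ¬ForInitLast α ¬sat
  ... | β , A , refl , ¬sat′ with comp β ∈ᵗ? X
  ...   | no β∉X = contradiction (λ β∈X → contradiction β∈X β∉X) ¬sat′
  ...   | yes β∈X with focus-occ s m
  ...     | _ , _ , _ , e with focus-before e (λ eq → ∷ʳ≢ β A (trans (sym (label-addSide s _ _)) eq))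
                                           (physical (invariantAt inv σ) (λ ()) β∈X)
  ...       | _ , _ , _ , e′ = expand-atom s below inv σ e′ λ p∈X → ¬sat′ (λ _ → p∈X)
  expand below inv σ (occ α L (¬' A)) m ¬sat with _ , _ , _ , e ← focus-occ L m = expand-L¬ below inv σ e ¬sat
  expand below inv σ (occ α R (¬' A)) m ¬sat with _ , _ , _ , e ← focus-occ R m = expand-R¬ below inv σ e ¬sat
  expand below inv σ (occ α L (A ∧' B)) m ¬sat with _ , _ , _ , e ← focus-occ L m = expand-L∧ below inv σ e ¬sat
  expand below inv σ (occ α R (A ∧' B)) m ¬sat with _ , _ , _ , e ← focus-occ R m = expand-R∧ below inv σ e ¬sat
  expand below inv σ (occ α L (□ A)) m ¬sat with _ , _ , _ , e ← focus-occ L m = expand-L□ below inv σ e ¬sat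
  expand below inv σ (occ α R (□ A)) m ¬sat with _ , _ , _ , e ← focus-occ R m = expand-R□ below inv σ e ¬sat
  expand below inv σ (occ α L (⟦ A ⟧ B)) m ¬sat with focus-occ L m
  ... | _ , _ , cs , e with any? (λ c → label c ≟ᵃ α ∷ʳ A) cs
  ...   | no fresh = expand-L⟦⟧-new below inv σ e (¬Any⇒All¬ cs fresh) ¬sat
  ...   | yes found with _ , _ , _ , e′ ← focus-after e found = expand-L⟦⟧ below inv σ e′ ¬sat
  expand below inv σ (occ α R (⟦ A ⟧ B)) m ¬sat with focus-occ R m
  ... | _ , _ , cs , e with any? (λ c → label c ≟ᵃ α ∷ʳ A) cs
  ...   | no fresh = expand-R⟦⟧-new below inv σ e (¬Any⇒All¬ cs fresh) ¬sat
  ...   | yes found with _ , _ , _ , e′ ← focus-after e found = expand-R⟦⟧ below inv σ e′ ¬sat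

  -- Countermodel of a saturated state

  occ⇒comp : ∀ {S X α s A} → Invariant S X → ¬ Consuming (occ α s A) → occ α s A ∈ᵗ X → comp α ∈ᵗ X
  occ⇒comp inv ¬consuming m = inj₁ (Any.map proj₁ (physical inv ¬consuming m))

  some-comp : ∀ X → 0 < length (comps X) → ∃[ α ] comp α ∈ᵗ X
  some-comp (tracked (c ∷ _) _) _ = label c , inj₁ (here refl)

  module Countermodel (S : State) (inv : StateInvariant S)
                      (saturated : All (λ X → ∀ {t} → t ∈ᵗ X → Saturated S X t) S)
                      (axiom-free : All (λ X → ¬ Any IsAxiom (comps X)) S) where

    M : Model
    M = record
      { W     = Fin (length S)
      ; _∼_   = λ _ _ → ⊤
      ; isEqv = record { refl = tt ; sym = λ _ → tt ; trans = λ _ _ → tt }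
      ; V     = λ p i → occ [] L (atom p) ∈ᵗ lookup S i
      }

    sequent : Fin (length S) → Tracked
    sequent = lookup S

    sat : ∀ i {t} → t ∈ᵗ sequent i → Saturated S (sequent i) t
    sat i = All.lookup saturated (∈-lookup i)

    invariant : ∀ i → Invariant S (sequent i)
    invariant i = All.lookup (proj₁ inv) (∈-lookup i)

    root-present : ∀ i → comp [] ∈ᵗ sequent i
    root-present i with α , m ← some-comp (sequent i) (Invariant.nonempty (invariant i)) = go (reverseView α) m
      where
      go : ∀ {α} → Reverse α → comp α ∈ᵗ sequent i → comp [] ∈ᵗ sequent i
      go []           m = m
      go (β ∶ r ∶ʳ A) m = go r (proj₁ (sat i m β A refl))

    atom-at-root : ∀ i {α s p} → occ α s (atom p) ∈ᵗ sequent i → occ [] s (atom p) ∈ᵗ sequent i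
    atom-at-root i {α} = go (reverseView α)
      where
      go : ∀ {α s p} → Reverse α → occ α s (atom p) ∈ᵗ sequent i → occ [] s (atom p) ∈ᵗ sequent i
      go []           m = m
      go (β ∶ r ∶ʳ A) m = go r (sat i m β A refl (proj₁ (sat i (occ⇒comp (invariant i) (λ ()) m) β A refl)))

    no-clash : ∀ i p → occ [] L (atom p) ∈ᵗ sequent i → ¬ occ [] R (atom p) ∈ᵗ sequent i
    no-clash i p pL pR =
      All.lookup axiom-free (∈-lookup i)
        (Any.map (λ { (p∈M , p∈N) → Any.map (λ { refl → is-atom p , p∈N }) p∈M })
                 (root-unique _ (Invariant.rootCount≤1 (invariant i))
                              (physical (invariant i) (λ ()) pL) (physical (invariant i) (λ ()) pR)))

    Holds : Side → Set → Set
    Holds L P = P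
    Holds R P = ¬ P

    TruthBelow : ℕ → Set
    TruthBelow n = ∀ i α s A → annSize α + size A < n → occ α s A ∈ᵗ sequent i →
                   (u : W (updates M α)) → origin M α u ≡ i → Holds s (Sat (updates M α) u A)

    WorldsBelow : ℕ → Set
    WorldsBelow n = ∀ i α → annSize α < n → comp α ∈ᵗ sequent i → ∃[ u ] origin M α u ≡ i

    worlds-step : ∀ {n} → TruthBelow n → WorldsBelow n → WorldsBelow (suc n)
    worlds-step truth worlds i α (s≤s le) m with initLast α
    ... | []      = i , refl
    ... | β ∷ʳ′ A with β∈ , A∈ ← sat i m β A refl | le′ ← subst (_≤ _) (annSize-∷ʳ β A) le
      with u , origin≡ ← worlds i β (<-≤-trans (m<m+n (annSize β) (s≤s z≤n)) le′) β∈ =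
      snocWorld M β A u h , trans (origin-snocWorld M β A u h) origin≡
      where
      h : Sat (updates M β) u A
      h = truth i β L A (<-≤-trans (+-monoʳ-< (annSize β) (n<1+n (size A))) le′) A∈ u origin≡

    refuted-prefix : ∀ {n} → TruthBelow n → ∀ α pre C suf → α ≡ pre ++ C ∷ suf → (v : W (updates M α)) →
                     annSize α < n → ¬ occ pre R C ∈ᵗ sequent (origin M α v)
    refuted-prefix truth .(pre ++ C ∷ suf) pre C suf refl v bound C∈ =
      truth _ pre R C (<-≤-trans (+-monoʳ-< (annSize pre) (n<1+n (size C)))
                                 (≤-trans (annSize-split pre C suf) (<⇒≤ bound)))
            C∈ (proj₁ w) (origin-prefixWorld M pre C suf v) (proj₂ w)
      where
      w : Σ (W (updates M pre)) λ w → Sat (updates M pre) w C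
      w = prefixWorld M pre C suf v

    truth-step : ∀ {n} → TruthBelow n → WorldsBelow n → TruthBelow (suc n)
    truth-step truth worlds _ α L (atom p) _ m u refl = subst id (sym (V-updates M α p u)) (atom-at-root _ m)
    truth-step truth worlds _ α R (atom p) _ m u refl v =
      no-clash _ p (subst id (V-updates M α p u) v) (atom-at-root _ m)
    truth-step truth worlds _ α L (¬' A) (s≤s le) m u refl =
      truth _ α R A (annSize+size-< α (n<1+n _) le) (sat _ m) u refl
    truth-step truth worlds _ α R (¬' A) (s≤s le) m u refl ¬a =
      ¬a (truth _ α L A (annSize+size-< α (n<1+n _) le) (sat _ m) u refl)
    truth-step truth worlds _ α L (A ∧' B) (s≤s le) m u refl with A∈ , B∈ ← sat _ m =
      truth _ α L A (annSize+size-< α (s≤s (m≤m+n _ _)) le) A∈ u refl ,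
      truth _ α L B (annSize+size-< α (s≤s (m≤n+m _ _)) le) B∈ u refl
    truth-step truth worlds _ α R (A ∧' B) (s≤s le) m u refl (a , b) with sat _ m
    ... | inj₁ A∈ = truth _ α R A (annSize+size-< α (s≤s (m≤m+n _ _)) le) A∈ u refl a
    ... | inj₂ B∈ = truth _ α R B (annSize+size-< α (s≤s (m≤n+m _ _)) le) B∈ u refl b
    truth-step truth worlds _ α L (□ A) (s≤s le) m u refl v _ with A∈ , propagated ← sat _ m
      with All.lookup propagated (∈-lookup (origin M α v)) (root-present (origin M α v))
    ... | inj₁ A∈v = truth _ α L A (annSize+size-< α (n<1+n _) le) A∈v v refl
    ... | inj₂ refuted with (pre , C , suf) , split∈ , C∈ ← find refuted =
      ⊥-elim (refuted-prefix truth α pre C suf (∈-splits⁻ α split∈) v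
                             (<-≤-trans (m<m+n (annSize α) (s≤s z≤n)) le) C∈)
    truth-step truth worlds _ α R (□ A) (s≤s le) m u refl everywhere
      with reached ← sat _ m with comp∈ , A∈ ← lookup-index reached
      with v , origin≡ ← worlds (index reached) α (<-≤-trans (m<m+n (annSize α) (s≤s z≤n)) le) comp∈ =
      truth _ α R A (annSize+size-< α (n<1+n _) le) A∈ v origin≡
            (everywhere v (updates-universal M (λ _ _ → tt) α u v))
    truth-step truth worlds _ α L (⟦ A ⟧ B) (s≤s le) m u refl h with sat _ m
    ... | inj₁ A∈ = ⊥-elim (truth _ α R A (annSize+size-< α (s≤s (m≤n⇒m≤1+n (m≤m+n _ _))) le) A∈ u refl h)
    ... | inj₂ B∈ = subst id (Sat-snocWorld M α A u h B)
                      (truth _ (α ∷ʳ A) L B (<-≤-trans (annSize-⟦⟧ α A B) le) B∈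
                             (snocWorld M α A u h) (origin-snocWorld M α A u h))
    truth-step truth worlds _ α R (⟦ A ⟧ B) (s≤s le) m u refl f with A∈ , B∈ ← sat _ m =
      truth _ (α ∷ʳ A) R B (<-≤-trans (annSize-⟦⟧ α A B) le) B∈ (snocWorld M α A u h) (origin-snocWorld M α A u h)
            (subst id (sym (Sat-snocWorld M α A u h B)) (f h))
      where
      h : Sat (updates M α) u A
      h = truth _ α L A (annSize+size-< α (s≤s (m≤n⇒m≤1+n (m≤m+n _ _))) le) A∈ u refl

    truth : ∀ n → TruthBelow n × WorldsBelow n
    truth zero    = (λ _ _ _ _ ()) , (λ _ _ ())
    truth (suc n) with t , w ← truth n = truth-step t w , worlds-step t w

    refutes : ¬ ⊨PAL A₀
    refutes valid with goal ← proj₂ inv =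
      proj₁ (truth (suc (size A₀))) (index goal) [] R A₀ ≤-refl (lookup-index goal) (index goal) refl
            (valid M (index goal))

  -- Proof search

  fully-saturated : ∀ {S X} → Invariant S X → All (Saturated S X) (concatMap itemsOf (comps X)) →
                    ∀ {t} → t ∈ᵗ X → Saturated S X t
  fully-saturated inv sat (inj₁ m) with c , c∈ , t∈c ← find m =
    All.lookup sat (∈-concatMap⁺′ itemsOf c∈ (∈ᶜ⇒∈itemsOf c t∈c))
  fully-saturated inv sat (inj₂ m) = proj₂ (All.lookup (Invariant.spent-saturated inv) m)

  close : ∀ {S} → Any (λ X → Any IsAxiom (comps X)) S → ⊢ (erase S)
  close axiom with X , axiomX , Rs , σ ← extract axiom
    with (α ▸ M ⇒ N) , axiomc , cs , π ← extract axiomX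
    with _ , (is-atom p , p∈N) , M′ , ρ ← extract axiomc
    with N′ , ρ′ ← ∈⇒↭ p∈N = conclude σ (≋-trans (≋-perm π) (≋-head ρ ρ′)) ax

  sequentSaturated? : ∀ S X → Dec (All (Saturated S X) (concatMap itemsOf (comps X)))
  sequentSaturated? S X = all? (saturated? S X) (concatMap itemsOf (comps X))

  step : ⊨PAL A₀ → ∀ S → StateInvariant S → Below S → ⊢ (erase S)
  step valid S inv below with any? (λ X → any? isAxiom? (comps X)) S
  ... | yes axiom = close axiom
  ... | no noAxiom with all? (sequentSaturated? S) S
  ...   | yes saturated =
    ⊥-elim (Countermodel.refutes S inv
              (All.zipWith (λ (i , s) {t} → fully-saturated i s {t}) (proj₁ inv , saturated))
                                 (¬Any⇒All¬ S noAxiom) valid)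
  ...   | no unsaturated with extract (¬All⇒Any¬ (sequentSaturated? S) S unsaturated)
  ...     | X , ¬saturatedX , Rs , σ with find (¬All⇒Any¬ (saturated? S X) _ ¬saturatedX)
  ...       | t , t∈ , ¬sat = expand below inv σ t (Any.map (λ {c} → ∈itemsOf⇒∈ᶜ c) (∈-concatMap⁻ itemsOf t∈)) ¬sat

  search : ⊨PAL A₀ → ∀ S → StateInvariant S → Acc _<_ (μ S) → ⊢ (erase S)
  search valid S inv (acc rs) = step valid S inv λ S′ inv′ μ< → search valid S′ inv′ (rs μ<)

  initial : StateInvariant (tracked (([] ▸ [] ⇒ [ A₀ ]) ∷ []) [] ∷ [])
  initial =
    (record { spent-saturated = [] ; rootCount≤1 = ≤-refl ; relevant = relevant ; nonempty = s≤s z≤n } ∷ []) ,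
            here (inj₁ occ₁)
    where
    relevant : ∀ {t} → t ∈ᵗ tracked (([] ▸ [] ⇒ [ A₀ ]) ∷ []) [] → Relevant t
    relevant {comp _}    (inj₁ (here refl))           = relevantComp tt z≤n
    relevant {occ _ R _} (inj₁ occ₁)                  = relevantOcc tt (A∈subformulas A₀) ≤-refl
    relevant {occ _ R _} (inj₁ (here (_ , there ())))
    relevant {occ _ L _} (inj₁ (here (_ , ())))
    relevant             (inj₁ (there ()))
    relevant             (inj₂ ())

  complete : ⊨PAL A₀ → ⊢ ((([] ▸ [] ⇒ [ A₀ ]) ∷ []) ∷ [])
  complete valid = search valid _ initial (<-wellFounded _)

mainTheorem3 : (A : Fm) → ⊨PAL A → ⊢ ((([] ▸ [] ⇒ [ A ]) ∷ []) ∷ [])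
mainTheorem3 A = Completeness.complete A
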